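{- Let $\dot G\in\mathcal C_1\cup\mathcal C_4\cup\mathcal C_5$ be a connected, non-complete, $6$-regular and $2$ net-regular strongly regular signed graph with parameters $(n,6,a,b,c)$. Then: - $(a,b)\neq(2,1)$; - if $(a,b)=(3,1)$, then $\dot G$ is isomorphic to $\dot S^1_{15}$ and has parameters $(15,6,3,1,-2)$. Here $\dot S^1_{15}$ is the Cartesian product $K_5\,\square\,K_3$ on vertices $(i,j)$, $i\in\{1,\dots,5\}$, $j\in\{1,2,3\}$. The edges $(i,j)(i',j)$ with $i\ne i'$ are positive, and the edges $(i,j)(i,j')$ with $j\ne j'$ are negative. There are no other edges.
   Context: Signed graphs. - A signed graph $\dot G=(G,\sigma)$ is a simple graph $G$ (the underlying graph) with a sign function $\sigma:E(G)\to\{\pm1\}$. - The adjacency matrix has entries $\sigma(v_iv_j)$ for adjacent pairs and $0$ otherwise. - Connected, complete and regular refer to $G$. - $\dot G$ is $\rho$ net-regular if every vertex has (number of positive incident edges) $-$ (number of negative incident edges) $=\rho$. - $\dot G$ is homogeneous if all edges have the same sign. - Isomorphism of signed graphs means a graph isomorphism preserving signs. Strongly regular signed graphs. - An SRSG is a signed graph on $n$ vertices, neither homogeneous complete nor edgeless, for which there are $r\in\mathbb N$ and $a,b,c\in\mathbb Z$ such that the entries of $A(\dot G)^2$ are: - $r$ on the diagonal; - $a$ for pairs joined by a positive edge; - $b$ for pairs joined by a negative edge; - $c$ for distinct non-adjacent pairs. - $(n,r,a,b,c)$ are its parameters. Classes of inhomogeneous SRSGs. - $\mathcal C_1$: $a=-b$,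 and either complete, or non-complete with $c\ne0$. - $\mathcal C_4$: $a\ne-b$, non-complete, $c=0$. - $\mathcal C_5$: $a\ne-b$, non-complete, $c\ne\frac{a+b}2$ and $c\neq0$. -}

module Defs where

open import Data.Nat using (ℕ; zero; suc)
open import Data.Integer as ℤ using (ℤ; +_; -_; _-_)
open import Data.Fin using (Fin; zero; suc; remQuot)
open import Data.Fin.Properties using (_≟_)
open import Data.Product using (_×_; _,_; Σ; ∃; ∃-syntax)
open import Data.Sum using (_⊎_)
open import Relation.Nullary using (¬_; yes; no)
open import Relation.Binary.PropositionalEquality using (_≡_; _≢_)
open import Function.Bundles using (_⤖_; Bijection)

data Edge : Set where
  none pos neg : Edge

-- A signed graph on vertex set Fin n is given by a function telling, for
-- each pair of vertices, whether they are non-adjacent, joined by a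
-- positive edge, or joined by a negative edge; it must be symmetric and
-- loopless (simple underlying graph).
SGraph : ℕ → Set
SGraph n = Fin n → Fin n → Edge

IsSignedGraph : ∀ {n} → SGraph n → Set
IsSignedGraph {n} G = (∀ i j → G i j ≡ G j i) × (∀ i → G i i ≡ none)

entry : Edge → ℤ
entry none = + 0
entry pos  = + 1
entry neg  = - (+ 1)

A : ∀ {n} → SGraph n → Fin n → Fin n → ℤ
A G i j = entry (G i j)

∑ : ∀ {n} → (Fin n → ℤ) → ℤ
∑ {zero}  f = + 0
∑ {suc n} f = f zero ℤ.+ ∑ (λ k → f (suc k))

countN : ∀ {n} → (Fin n → ℕ) → ℕ
countN {zero}  f = 0
countN {suc n} f = f zero Data.Nat.+ countN (λ k → f (suc k))

A² : ∀ {n} → SGraph n → Fin n → Fin n → ℤ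
A² G i j = ∑ (λ k → A G i k ℤ.* A G k j)

isPos isNeg isAdj : Edge → ℕ
isPos pos = 1
isPos _   = 0
isNeg neg = 1
isNeg _   = 0
isAdj none = 0
isAdj _    = 1

degree posDeg negDeg : ∀ {n} → SGraph n → Fin n → ℕ
degree G i = countN (λ k → isAdj (G i k))
posDeg G i = countN (λ k → isPos (G i k))
negDeg G i = countN (λ k → isNeg (G i k))

Regular : ∀ {n} → SGraph n → ℕ → Set
Regular G r = ∀ i → degree G i ≡ r

NetRegular : ∀ {n} → SGraph n → ℤ → Set
NetRegular G ρ = ∀ i → (+ posDeg G i) - (+ negDeg G i) ≡ ρ

Adjacent : ∀ {n} → SGraph n → Fin n → Fin n → Set
Adjacent G i j = G i j ≢ none

data Reach {n} (G : SGraph n) (i : Fin n) : Fin n → Set where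
  here : Reach G i i
  step : ∀ {j k} → Reach G i j → Adjacent G j k → Reach G i k

Connected : ∀ {n} → SGraph n → Set
Connected G = ∀ i j → Reach G i j

Complete : ∀ {n} → SGraph n → Set
Complete G = ∀ i j → i ≢ j → Adjacent G i j

Edgeless : ∀ {n} → SGraph n → Set
Edgeless G = ∀ i j → G i j ≡ none

Homogeneous : ∀ {n} → SGraph n → Set
Homogeneous G = (∀ i j → G i j ≢ neg) ⊎ (∀ i j → G i j ≢ pos)

IsSRSG : ∀ {n} → SGraph n → ℕ → ℤ → ℤ → ℤ → Set
IsSRSG G r a b c =
    ¬ (Homogeneous G × Complete G)
  × ¬ Edgeless G
  × (∀ i → A² G i i ≡ + r)
  × (∀ i j → G i j ≡ pos → A² G i j ≡ a)
  × (∀ i j → G i j ≡ neg → A² G i j ≡ b)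
  × (∀ i j → i ≢ j → G i j ≡ none → A² G i j ≡ c)

C₁ C₄ C₅ : ∀ {n} → SGraph n → ℤ → ℤ → ℤ → Set
C₁ G a b c = ¬ Homogeneous G × a ≡ - b × (Complete G ⊎ (¬ Complete G × c ≢ + 0))
C₄ G a b c = ¬ Homogeneous G × a ≢ - b × ¬ Complete G × c ≡ + 0
-- c ≠ (a+b)/2 is written as 2c ≠ a + b.
C₅ G a b c = ¬ Homogeneous G × a ≢ - b × ¬ Complete G
             × (+ 2) ℤ.* c ≢ a ℤ.+ b × c ≢ + 0

Isomorphic : ∀ {n m} → SGraph n → SGraph m → Set
Isomorphic {n} {m} G H =
  Σ (Fin n ⤖ Fin m) λ f → ∀ i j → H (Bijection.to f i) (Bijection.to f j) ≡ G i j

-- Ṡ¹₁₅ = K₅ □ K₃: vertex v ↔ (i , j) = remQuot 3 v, i ∈ Fin 5, j ∈ Fin 3.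
S15edge : (Fin 5 × Fin 3) → (Fin 5 × Fin 3) → Edge
S15edge (i , j) (i' , j') with i ≟ i' | j ≟ j'
... | no _  | yes _ = pos
... | yes _ | no _  = neg
... | _     | _     = none

S¹₁₅ : SGraph 15
S¹₁₅ u v = S15edge (remQuot 3 u) (remQuot 3 v)

-- Write A = A⁺ − A⁻, with A⁺ and A⁻ the 0/1 matrices of positive and negative edges. Strong
-- regularity says A² = (6 − c)I + (a − c)A⁺ + (b − c)A⁻ + cJ, and net-regularity makes A commute
-- with J, so comparing A·A² with A²·A gives (a + b − 2c)(A⁺A⁻ − A⁻A⁺) = 0; in all three classes
-- 2c ≠ a + b, hence A⁺A⁻ = A⁻A⁺. Every vertex v has four positive and two negative neighbours.
-- Reading the rows of A⁺A² and A⁻A² at v through this commutation, and counting the ordered pairs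
-- of neighbours of v of each sign joined positively, negatively or not at all, leaves a small
-- linear system with very few solutions.
-- For (a, b) = (2, 1) it forces the positive neighbours of v to form a positive 4-cycle. Two
-- opposite vertices of the cycle have at least three common positive neighbours and at most one
-- walk of signs +, − between them, so c ≥ 0, contradicting the row sum 4 = 16 + c(n − 7) of A².
-- For (a, b) = (3, 1) it forces v and its positive (negative) neighbours to span a positive K₅
-- (negative K₃). Then c = −2, any two non-adjacent vertices are joined by a walk of signs +, −,
-- and sending a vertex to its positive and its negative clique is an isomorphism onto K₅ □ K₃.

module Submission where

open import Defs
open import Data.Nat.Base using (ℕ; zero; suc)
open import Data.Integer.Base using (ℤ; +_; -_)
import Data.Integer.Base as ℤ
open import Data.Fin.Base using (Fin; zero; suc; combine; remQuot)
open import Data.Fin.Properties using (_≟_; suc-injective; ¬Fin0; remQuot-combine; combine-remQuot)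
open import Data.Product.Base using (_×_; _,_; ∃-syntax; proj₁; proj₂; uncurry)
open import Function.Bundles using (mk⤖)
open import Function.Properties.Bijection using (⤖⇒↔)
open import Data.Fin.Permutation using (↔⇒≡)
open import Function.Consequences.Propositional using (strictlySurjective⇒surjective)
open import Data.Sum.Base using (_⊎_; inj₁; inj₂; fromInj₂)
open import Data.Empty using (⊥; ⊥-elim)
open import Function.Base using (_∘_)
open import Relation.Nullary using (¬_; yes; no)
open import Relation.Binary.PropositionalEquality
open import Relation.Binary.Structures using (IsEquivalence)

pos≢none : pos ≢ none
pos≢none ()

neg≢none : neg ≢ none
neg≢none ()

pos≢neg : pos ≢ neg
pos≢neg ()

δ : ∀ {n} → Fin n → Fin n → ℕ
δ i j with i ≟ j
... | yes _ = 1
... | no  _ = 0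

δ-refl : ∀ {n} (i : Fin n) → δ i i ≡ 1
δ-refl i with i ≟ i
... | yes _   = refl
... | no  i≢i = ⊥-elim (i≢i refl)

δ-≢ : ∀ {n} {i j : Fin n} → i ≢ j → δ i j ≡ 0
δ-≢ {i = i} {j} i≢j with i ≟ j
... | yes i≡j = ⊥-elim (i≢j i≡j)
... | no  _   = refl

δ-sym : ∀ {n} (i j : Fin n) → δ i j ≡ δ j i
δ-sym i j with i ≟ j | j ≟ i
... | yes _   | yes _   = refl
... | no  _   | no  _   = refl
... | yes i≡j | no  j≢i = ⊥-elim (j≢i (sym i≡j))
... | no  i≢j | yes j≡i = ⊥-elim (i≢j (sym j≡i))

module NatSums where
  open import Data.Nat.Base using (_+_; _*_; _≤_; z≤n)
  open import Data.Nat.Properties hiding (_≟_)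
  open import Data.Nat.Properties using () renaming (_≟_ to _≟ℕ_)
  open import Algebra.Properties.CommutativeSemigroup +-commutativeSemigroup using (interchange)
  open import Data.Nat.Tactic.RingSolver using (solve-∀)

  countN-cong : ∀ {n} {f g : Fin n → ℕ} → (∀ k → f k ≡ g k) → countN f ≡ countN g
  countN-cong {zero}  f≗g = refl
  countN-cong {suc n} f≗g = cong₂ _+_ (f≗g zero) (countN-cong (λ k → f≗g (suc k)))

  countN-distrib-+ : ∀ {n} (f g : Fin n → ℕ) → countN (λ k → f k + g k) ≡ countN f + countN g
  countN-distrib-+ {zero}  f g = refl
  countN-distrib-+ {suc n} f g =
    trans (cong (_+_ (f zero + g zero)) (countN-distrib-+ (λ k → f (suc k)) (λ k → g (suc k))))
          (interchange (f zero) (g zero) _ _)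

  countN-*ˡ : ∀ {n} c (f : Fin n → ℕ) → countN (λ k → c * f k) ≡ c * countN f
  countN-*ˡ {zero}  c f = sym (*-zeroʳ c)
  countN-*ˡ {suc n} c f =
    trans (cong (_+_ (c * f zero)) (countN-*ˡ c (λ k → f (suc k)))) (sym (*-distribˡ-+ c (f zero) _))

  countN-*ʳ : ∀ {n} c (f : Fin n → ℕ) → countN (λ k → f k * c) ≡ countN f * c
  countN-*ʳ c f = trans (countN-cong (λ k → *-comm (f k) c)) (trans (countN-*ˡ c f) (*-comm c _))

  countN-const : ∀ {n} c → countN {n} (λ _ → c) ≡ n * c
  countN-const {zero}  c = refl
  countN-const {suc n} c = cong (_+_ c) (countN-const {n} c)

  countN-swap : ∀ {m n} (f : Fin m → Fin n → ℕ) →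
                countN (λ i → countN (f i)) ≡ countN (λ j → countN (λ i → f i j))
  countN-swap {zero}  {n} f = sym (trans (countN-const {n} 0) (*-zeroʳ n))
  countN-swap {suc m} f =
    trans (cong (_+_ (countN (f zero))) (countN-swap (λ i → f (suc i))))
          (sym (countN-distrib-+ (f zero) _))

  countN-single : ∀ {n} (f : Fin n → ℕ) j → (∀ k → k ≢ j → f k ≡ 0) → countN f ≡ f j
  countN-single {suc n} f zero f≡0 =
    trans (cong (_+_ (f zero)) (trans (countN-cong (λ k → f≡0 (suc k) λ ())) (countN-const {n} 0)))
          (trans (cong (_+_ (f zero)) (*-zeroʳ n)) (+-identityʳ (f zero)))
  countN-single {suc n} f (suc j) f≡0 =
    trans (cong (_+ countN (λ k → f (suc k))) (f≡0 zero λ ()))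
          (countN-single (λ k → f (suc k)) j (λ k k≢j → f≡0 (suc k) (λ { refl → k≢j refl })))

  countN-δ : ∀ {n} (f : Fin n → ℕ) j → countN (λ k → f k * δ k j) ≡ f j
  countN-δ f j = trans (countN-single (λ k → f k * δ k j) j (λ k k≢j → trans (cong (f k *_) (δ-≢ k≢j)) (*-zeroʳ (f k))))
                       (trans (cong (f j *_) (δ-refl j)) (*-identityʳ (f j)))

  countN-δ-row : ∀ {n} (i : Fin n) → countN (δ i) ≡ 1
  countN-δ-row i = trans (countN-single (δ i) i (λ j j≢i → δ-≢ (λ i≡j → j≢i (sym i≡j)))) (δ-refl i)

  countN≡0⇒≡0 : ∀ {n} (f : Fin n → ℕ) → countN f ≡ 0 → ∀ k → f k ≡ 0
  countN≡0⇒≡0 {suc n} f ∑≡0 zero    = m+n≡0⇒m≡0 (f zero) ∑≡0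
  countN≡0⇒≡0 {suc n} f ∑≡0 (suc k) = countN≡0⇒≡0 (λ k → f (suc k)) (m+n≡0⇒n≡0 (f zero) ∑≡0) k

  ≡0⇒countN≡0 : ∀ {n} (f : Fin n → ℕ) → (∀ k → f k ≡ 0) → countN f ≡ 0
  ≡0⇒countN≡0 {n} f f≡0 = trans (countN-cong f≡0) (trans (countN-const {n} 0) (*-zeroʳ n))

  ¬both≢0⇒m*n≡0 : ∀ {m n} → (m ≢ 0 → n ≢ 0 → ⊥) → m * n ≡ 0
  ¬both≢0⇒m*n≡0 {zero}          _     = refl
  ¬both≢0⇒m*n≡0 {suc m} {zero}  _     = *-zeroʳ (suc m)
  ¬both≢0⇒m*n≡0 {suc m} {suc n} ¬both = ⊥-elim (¬both (λ ()) (λ ()))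

  m*n≢0⇒≢0 : ∀ m n → m * n ≢ 0 → m ≢ 0 × n ≢ 0
  m*n≢0⇒≢0 m n mn≢0 = (λ m≡0 → mn≢0 (cong (_* n) m≡0)) , (λ n≡0 → mn≢0 (trans (cong (m *_) n≡0) (*-zeroʳ m)))

  countN≢0⇒∃≢0 : ∀ {n} (f : Fin n → ℕ) → countN f ≢ 0 → ∃[ k ] f k ≢ 0
  countN≢0⇒∃≢0 {zero}  f ∑≢0 = ⊥-elim (∑≢0 refl)
  countN≢0⇒∃≢0 {suc n} f ∑≢0 with f zero ≟ℕ 0
  ... | no  f₀≢0 = zero , f₀≢0
  ... | yes f₀≡0 with countN≢0⇒∃≢0 (λ k → f (suc k)) (λ ∑≡0 → ∑≢0 (cong₂ _+_ f₀≡0 ∑≡0))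
  ...   | k , fₖ≢0 = suc k , fₖ≢0

  countN-mono-≤ : ∀ {n} {f g : Fin n → ℕ} → (∀ k → f k ≤ g k) → countN f ≤ countN g
  countN-mono-≤ {zero}  f≤g = z≤n
  countN-mono-≤ {suc n} f≤g = +-mono-≤ (f≤g zero) (countN-mono-≤ (λ k → f≤g (suc k)))

  countN²-even : ∀ {n} (h : Fin n → Fin n → ℕ) → (∀ i j → h i j ≡ h j i) → (∀ i → h i i ≡ 0) →
                 ∃[ m ] countN (λ i → countN (h i)) ≡ m + m
  countN²-even {zero}  h sym-h diag-h = 0 , refl
  countN²-even {suc n} h sym-h diag-h
    with countN²-even (λ i j → h (suc i) (suc j)) (λ i j → sym-h (suc i) (suc j)) (λ i → diag-h (suc i))
  ... | m , inner = row + m , (begin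
        h zero zero + row + countN (λ i → h (suc i) zero + countN (λ j → h (suc i) (suc j)))
          ≡⟨ cong₂ (λ d s → d + row + s) (diag-h zero)
                   (countN-distrib-+ (λ i → h (suc i) zero) (λ i → countN (λ j → h (suc i) (suc j)))) ⟩
        row + (column + countN (λ i → countN (λ j → h (suc i) (suc j))))
          ≡⟨ cong₂ (λ c s → row + (c + s)) (countN-cong (λ i → sym-h (suc i) zero)) inner ⟩
        row + (row + (m + m))
          ≡⟨ regroup row m ⟩
        row + m + (row + m) ∎)
    where
    open ≡-Reasoning
    row column : ℕ
    row    = countN (λ j → h zero (suc j))
    column = countN (λ i → h (suc i) zero)
    regroup : ∀ r m → r + (r + (m + m)) ≡ r + m + (r + m)
    regroup = solve-∀

module IntSums where
  open import Data.Integer.Base using (_+_; _-_; _*_)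
  open import Data.Integer.Properties hiding (_≟_)
  open import Algebra.Properties.CommutativeSemigroup +-commutativeSemigroup using (interchange)

  ∑-cong : ∀ {n} {f g : Fin n → ℤ} → (∀ k → f k ≡ g k) → ∑ f ≡ ∑ g
  ∑-cong {zero}  f≗g = refl
  ∑-cong {suc n} f≗g = cong₂ _+_ (f≗g zero) (∑-cong (λ k → f≗g (suc k)))

  ∑-distrib-+ : ∀ {n} (f g : Fin n → ℤ) → ∑ (λ k → f k + g k) ≡ ∑ f + ∑ g
  ∑-distrib-+ {zero}  f g = refl
  ∑-distrib-+ {suc n} f g =
    trans (cong (_+_ (f zero + g zero)) (∑-distrib-+ (λ k → f (suc k)) (λ k → g (suc k))))
          (interchange (f zero) (g zero) _ _)

  ∑-neg : ∀ {n} (f : Fin n → ℤ) → ∑ (λ k → - f k) ≡ - ∑ f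
  ∑-neg {zero}  f = refl
  ∑-neg {suc n} f =
    trans (cong (_+_ (- f zero)) (∑-neg (λ k → f (suc k)))) (sym (neg-distrib-+ (f zero) _))

  ∑-distrib-- : ∀ {n} (f g : Fin n → ℤ) → ∑ (λ k → f k - g k) ≡ ∑ f - ∑ g
  ∑-distrib-- f g = trans (∑-distrib-+ f (λ k → - g k)) (cong (_+_ (∑ f)) (∑-neg g))

  ∑-*ˡ : ∀ {n} c (f : Fin n → ℤ) → ∑ (λ k → c * f k) ≡ c * ∑ f
  ∑-*ˡ {zero}  c f = sym (*-zeroʳ c)
  ∑-*ˡ {suc n} c f =
    trans (cong (_+_ (c * f zero)) (∑-*ˡ c (λ k → f (suc k)))) (sym (*-distribˡ-+ c (f zero) _))

  ∑-*ʳ : ∀ {n} c (f : Fin n → ℤ) → ∑ (λ k → f k * c) ≡ ∑ f * c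
  ∑-*ʳ c f = trans (∑-cong (λ k → *-comm (f k) c)) (trans (∑-*ˡ c f) (*-comm c _))

  ∑-zero : ∀ {n} → ∑ {n} (λ _ → + 0) ≡ + 0
  ∑-zero {zero}  = refl
  ∑-zero {suc n} = trans (+-identityˡ _) (∑-zero {n})

  ∑-swap : ∀ {m n} (f : Fin m → Fin n → ℤ) → ∑ (λ i → ∑ (f i)) ≡ ∑ (λ j → ∑ (λ i → f i j))
  ∑-swap {zero}  {n} f = sym (∑-zero {n})
  ∑-swap {suc m} f =
    trans (cong (_+_ (∑ (f zero))) (∑-swap (λ i → f (suc i)))) (sym (∑-distrib-+ (f zero) _))

  ∑-single : ∀ {n} (f : Fin n → ℤ) j → (∀ k → k ≢ j → f k ≡ + 0) → ∑ f ≡ f j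
  ∑-single {suc n} f zero f≡0 =
    trans (cong (_+_ (f zero)) (trans (∑-cong (λ k → f≡0 (suc k) λ ())) (∑-zero {n})))
          (+-identityʳ (f zero))
  ∑-single {suc n} f (suc j) f≡0 =
    trans (cong (_+ ∑ (λ k → f (suc k))) (f≡0 zero λ ()))
          (trans (+-identityˡ _) (∑-single (λ k → f (suc k)) j (λ k k≢j → f≡0 (suc k) (λ { refl → k≢j refl }))))

  ∑-δ : ∀ {n} (f : Fin n → ℤ) j → ∑ (λ k → f k * + δ k j) ≡ f j
  ∑-δ f j = trans (∑-single (λ k → f k * + δ k j) j (λ k k≢j → trans (cong (λ d → f k * + d) (δ-≢ k≢j)) (*-zeroʳ (f k))))
                  (trans (cong (λ d → f j * + d) (δ-refl j)) (*-identityʳ (f j)))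

  ∑-countN : ∀ {n} (f : Fin n → ℕ) → ∑ (λ k → + f k) ≡ + countN f
  ∑-countN {zero}  f = refl
  ∑-countN {suc n} f = trans (cong (_+_ (+ f zero)) (∑-countN (λ k → f (suc k)))) (sym (pos-+ (f zero) _))

  ∑-signed : ∀ {n} (f₁ f₂ f₃ f₄ : Fin n → ℕ) →
             ∑ (λ k → + f₁ k - + f₂ k - + f₃ k + + f₄ k) ≡ + countN f₁ - + countN f₂ - + countN f₃ + + countN f₄
  ∑-signed f₁ f₂ f₃ f₄ =
    trans (∑-distrib-+ (λ k → + f₁ k - + f₂ k - + f₃ k) (λ k → + f₄ k))
      (cong₂ _+_ (trans (∑-distrib-- (λ k → + f₁ k - + f₂ k) (λ k → + f₃ k))
                   (cong₂ _-_ (trans (∑-distrib-- (λ k → + f₁ k) (λ k → + f₂ k))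
                                (cong₂ _-_ (∑-countN f₁) (∑-countN f₂)))
                              (∑-countN f₃)))
                 (∑-countN f₄))

  ∑-lincomb : ∀ {n} (α β γ c : ℤ) (f g h e : Fin n → ℤ) →
              ∑ (λ k → α * f k + β * g k + γ * h k + c * e k) ≡ α * ∑ f + β * ∑ g + γ * ∑ h + c * ∑ e
  ∑-lincomb α β γ c f g h e =
    trans (∑-distrib-+ (λ k → α * f k + β * g k + γ * h k) (λ k → c * e k))
      (cong₂ _+_ (trans (∑-distrib-+ (λ k → α * f k + β * g k) (λ k → γ * h k))
                   (cong₂ _+_ (trans (∑-distrib-+ (λ k → α * f k) (λ k → β * g k))
                                (cong₂ _+_ (∑-*ˡ α f) (∑-*ˡ β g)))
                              (∑-*ˡ γ h)))
                 (∑-*ˡ c e))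

module Matrices where
  open import Data.Integer.Base using (_+_; _-_; _*_)
  open import Data.Integer.Properties hiding (_≟_)
  open import Data.Integer.Tactic.RingSolver using (solve-∀)
  open IntSums

  Matrix : ℕ → Set
  Matrix n = Fin n → Fin n → ℤ

  infixl 7 _∙_
  _∙_ : ∀ {n} → Matrix n → Matrix n → Matrix n
  (M ∙ N) i j = ∑ λ k → M i k * N k j

  ∙-cong : ∀ {n} {M M′ N N′ : Matrix n} → (∀ i j → M i j ≡ M′ i j) → (∀ i j → N i j ≡ N′ i j) →
           ∀ i j → (M ∙ N) i j ≡ (M′ ∙ N′) i j
  ∙-cong M≗M′ N≗N′ i j = ∑-cong (λ k → cong₂ _*_ (M≗M′ i k) (N≗N′ k j))

  ∙-assoc : ∀ {n} (M N O : Matrix n) i j → ((M ∙ N) ∙ O) i j ≡ (M ∙ (N ∙ O)) i j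
  ∙-assoc M N O i j = begin
    ∑ (λ k → ∑ (λ m → M i m * N m k) * O k j)      ≡⟨ ∑-cong (λ k → sym (∑-*ʳ (O k j) (λ m → M i m * N m k))) ⟩
    ∑ (λ k → ∑ (λ m → M i m * N m k * O k j))      ≡⟨ ∑-swap (λ k m → M i m * N m k * O k j) ⟩
    ∑ (λ m → ∑ (λ k → M i m * N m k * O k j))      ≡⟨ ∑-cong (λ m → trans (∑-cong (λ k → *-assoc (M i m) (N m k) (O k j)))
                                                                          (∑-*ˡ (M i m) (λ k → N m k * O k j))) ⟩
    ∑ (λ m → M i m * ∑ (λ k → N m k * O k j))      ∎
    where open ≡-Reasoning

  ∙-distribˡ-- : ∀ {n} (M N O : Matrix n) i j → (M ∙ (λ k l → N k l - O k l)) i j ≡ (M ∙ N) i j - (M ∙ O) i j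
  ∙-distribˡ-- M N O i j =
    trans (∑-cong (λ k → *-distribˡ-+ (M i k) (N k j) (- O k j)))
          (trans (∑-cong (λ k → cong (_+_ (M i k * N k j)) (sym (neg-distribʳ-* (M i k) (O k j)))))
                 (∑-distrib-- (λ k → M i k * N k j) (λ k → M i k * O k j)))

  ∙-distribʳ-- : ∀ {n} (M N O : Matrix n) i j → ((λ k l → M k l - N k l) ∙ O) i j ≡ (M ∙ O) i j - (N ∙ O) i j
  ∙-distribʳ-- M N O i j =
    trans (∑-cong (λ k → *-distribʳ-+ (O k j) (M i k) (- N i k)))
          (trans (∑-cong (λ k → cong (_+_ (M i k * O k j)) (sym (neg-distribˡ-* (N i k) (O k j)))))
                 (∑-distrib-- (λ k → M i k * O k j) (λ k → N i k * O k j)))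

  module _ {n} (X Y : Matrix n) (α β γ c : ℤ) where
    private
      D : Matrix n
      D i j = X i j - Y i j

      L : Matrix n
      L i j = α * + δ i j + β * X i j + γ * Y i j + c

    ∙-lincombʳ : ∀ (M : Matrix n) i j → (M ∙ L) i j ≡ α * M i j + β * (M ∙ X) i j + γ * (M ∙ Y) i j + c * ∑ (M i)
    ∙-lincombʳ M i j =
      trans (∑-cong (λ k → distribute α β γ c (M i k) (+ δ k j) (X k j) (Y k j)))
            (trans (∑-lincomb α β γ c (λ k → M i k * + δ k j) (λ k → M i k * X k j) (λ k → M i k * Y k j) (M i))
                   (cong (λ m → α * m + β * (M ∙ X) i j + γ * (M ∙ Y) i j + c * ∑ (M i)) (∑-δ (M i) j)))
      where
      distribute : ∀ α β γ c m d x y → m * (α * d + β * x + γ * y + c) ≡ α * (m * d) + β * (m * x) + γ * (m * y) + c * m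
      distribute = solve-∀

    ∙-lincombˡ : ∀ (M : Matrix n) i j → (L ∙ M) i j ≡ α * M i j + β * (X ∙ M) i j + γ * (Y ∙ M) i j + c * ∑ (λ k → M k j)
    ∙-lincombˡ M i j =
      trans (∑-cong (λ k → trans (cong (λ d → (α * + d + β * X i k + γ * Y i k + c) * M k j) (δ-sym i k))
                                 (distribute α β γ c (M k j) (+ δ k i) (X i k) (Y i k))))
            (trans (∑-lincomb α β γ c (λ k → M k j * + δ k i) (λ k → X i k * M k j) (λ k → Y i k * M k j) (λ k → M k j))
                   (cong (λ m → α * m + β * (X ∙ M) i j + γ * (Y ∙ M) i j + c * ∑ (λ k → M k j)) (∑-δ (λ k → M k j) i)))
      where
      distribute : ∀ α β γ c m d x y → (α * d + β * x + γ * y + c) * m ≡ α * (m * d) + β * (x * m) + γ * (y * m) + c * m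
      distribute = solve-∀

    -- Expand both sides of D(DD) = (DD)D with the given square; what survives is (β + γ)(XY − YX).
    parts-commute : ∀ {ρ} → (∀ i → ∑ (D i) ≡ ρ) → (∀ j → ∑ (λ k → D k j) ≡ ρ) →
                    (∀ i j → (D ∙ D) i j ≡ L i j) → β + γ ≢ + 0 →
                    ∀ i j → (X ∙ Y) i j ≡ (Y ∙ X) i j
    parts-commute {ρ} rows columns square β+γ≢0 i j =
      i-j≡0⇒i≡j _ _ (fromInj₂ (λ β+γ≡0 → ⊥-elim (β+γ≢0 β+γ≡0)) (i*j≡0⇒i≡0∨j≡0 (β + γ) key))
      where
      open ≡-Reasoning
      xx xy yx yy : ℤ
      xx = (X ∙ X) i j
      xy = (X ∙ Y) i j
      yx = (Y ∙ X) i j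
      yy = (Y ∙ Y) i j

      left : (D ∙ (D ∙ D)) i j ≡ α * D i j + β * (xx - yx) + γ * (xy - yy) + c * ρ
      left = begin
        (D ∙ (D ∙ D)) i j
          ≡⟨ ∙-cong {M = D} (λ _ _ → refl) square i j ⟩
        (D ∙ L) i j
          ≡⟨ ∙-lincombʳ D i j ⟩
        α * D i j + β * (D ∙ X) i j + γ * (D ∙ Y) i j + c * ∑ (D i)
          ≡⟨ cong₂ (λ u w → α * D i j + β * u + γ * w + c * ∑ (D i)) (∙-distribʳ-- X Y X i j) (∙-distribʳ-- X Y Y i j) ⟩
        α * D i j + β * (xx - yx) + γ * (xy - yy) + c * ∑ (D i)
          ≡⟨ cong (λ r → α * D i j + β * (xx - yx) + γ * (xy - yy) + c * r) (rows i) ⟩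
        α * D i j + β * (xx - yx) + γ * (xy - yy) + c * ρ ∎

      right : ((D ∙ D) ∙ D) i j ≡ α * D i j + β * (xx - xy) + γ * (yx - yy) + c * ρ
      right = begin
        ((D ∙ D) ∙ D) i j
          ≡⟨ ∙-cong {N = D} square (λ _ _ → refl) i j ⟩
        (L ∙ D) i j
          ≡⟨ ∙-lincombˡ D i j ⟩
        α * D i j + β * (X ∙ D) i j + γ * (Y ∙ D) i j + c * ∑ (λ k → D k j)
          ≡⟨ cong₂ (λ u w → α * D i j + β * u + γ * w + c * ∑ (λ k → D k j)) (∙-distribˡ-- X X Y i j) (∙-distribˡ-- Y X Y i j) ⟩
        α * D i j + β * (xx - xy) + γ * (yx - yy) + c * ∑ (λ k → D k j)
          ≡⟨ cong (λ r → α * D i j + β * (xx - xy) + γ * (yx - yy) + c * r) (columns j) ⟩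
        α * D i j + β * (xx - xy) + γ * (yx - yy) + c * ρ ∎

      difference : ∀ α β γ c ρ d xx xy yx yy →
                   (β + γ) * (xy - yx) ≡ (α * d + β * (xx - yx) + γ * (xy - yy) + c * ρ)
                                         - (α * d + β * (xx - xy) + γ * (yx - yy) + c * ρ)
      difference = solve-∀

      key : (β + γ) * (xy - yx) ≡ + 0
      key = begin
        (β + γ) * (xy - yx)                    ≡⟨ difference α β γ c ρ (D i j) xx xy yx yy ⟩
        (α * D i j + β * (xx - yx) + γ * (xy - yy) + c * ρ)
          - (α * D i j + β * (xx - xy) + γ * (yx - yy) + c * ρ)
                                               ≡⟨ cong₂ _-_ (sym left) (sym right) ⟩
        (D ∙ (D ∙ D)) i j - ((D ∙ D) ∙ D) i j  ≡⟨ cong (_- ((D ∙ D) ∙ D) i j) (sym (∙-assoc D D D i j)) ⟩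
        ((D ∙ D) ∙ D) i j - ((D ∙ D) ∙ D) i j  ≡⟨ +-inverseʳ (((D ∙ D) ∙ D) i j) ⟩
        + 0                                    ∎

module Forms where
  open import Data.Nat.Base using (_+_; _*_; ≢-nonZero)
  open import Data.Nat.Properties hiding (_≟_)
  open import Data.Nat.Tactic.RingSolver using (solve-∀)
  open NatSums

  infixl 7 _⊙_
  _⊙_ : ∀ {n} → (Fin n → Fin n → ℕ) → (Fin n → Fin n → ℕ) → Fin n → Fin n → ℕ
  (M ⊙ N) i j = countN λ k → M i k * N k j

  -- ∑ₖ ∑ₚ f k · H k p · g p: for 0/1 vectors f and g, the number of ordered pairs (k, p)
  -- from the two supports with H k p = 1.
  ⟨_∣_∣_⟩ : ∀ {n} → (Fin n → ℕ) → (Fin n → Fin n → ℕ) → (Fin n → ℕ) → ℕ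
  ⟨ f ∣ H ∣ g ⟩ = countN λ p → countN (λ k → f k * H k p) * g p

  *-reverse : ∀ a b c → a * b * c ≡ c * b * a
  *-reverse = solve-∀

  ⟨⟩-sym : ∀ {n} (f : Fin n → ℕ) H g → (∀ k p → H k p ≡ H p k) → ⟨ f ∣ H ∣ g ⟩ ≡ ⟨ g ∣ H ∣ f ⟩
  ⟨⟩-sym f H g H-sym = begin
    countN (λ p → countN (λ k → f k * H k p) * g p)  ≡⟨ countN-cong (λ p → sym (countN-*ʳ (g p) (λ k → f k * H k p))) ⟩
    countN (λ p → countN (λ k → f k * H k p * g p))  ≡⟨ countN-swap (λ p k → f k * H k p * g p) ⟩
    countN (λ k → countN (λ p → f k * H k p * g p))  ≡⟨ countN-cong (λ k → trans (countN-cong (λ p → rearrange k p))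
                                                                                   (countN-*ʳ (f k) (λ p → g p * H p k))) ⟩
    countN (λ k → countN (λ p → g p * H p k) * f k)  ∎
    where
    open ≡-Reasoning
    rearrange : ∀ k p → f k * H k p * g p ≡ g p * H p k * f k
    rearrange k p = trans (cong (λ h → f k * h * g p) (H-sym k p)) (*-reverse (f k) (H p k) (g p))

  ⟨⟩-distrib-+ : ∀ {n} (f : Fin n → ℕ) H K g → ⟨ f ∣ (λ k p → H k p + K k p) ∣ g ⟩ ≡ ⟨ f ∣ H ∣ g ⟩ + ⟨ f ∣ K ∣ g ⟩
  ⟨⟩-distrib-+ f H K g =
    trans (countN-cong (λ p → trans (cong (_* g p) (trans (countN-cong (λ k → *-distribˡ-+ (f k) (H k p) (K k p)))
                                                           (countN-distrib-+ (λ k → f k * H k p) (λ k → f k * K k p))))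
                                    (*-distribʳ-+ (g p) (countN (λ k → f k * H k p)) _)))
          (countN-distrib-+ (λ p → countN (λ k → f k * H k p) * g p) _)

  ⟨⟩-δ : ∀ {n} (f g : Fin n → ℕ) → ⟨ f ∣ δ ∣ g ⟩ ≡ countN (λ p → f p * g p)
  ⟨⟩-δ f g = countN-cong (λ p → cong (_* g p) (countN-δ f p))

  ⟨⟩-one : ∀ {n} (f g : Fin n → ℕ) → ⟨ f ∣ (λ _ _ → 1) ∣ g ⟩ ≡ countN f * countN g
  ⟨⟩-one f g = trans (countN-cong (λ p → cong (_* g p) (countN-cong (λ k → *-identityʳ (f k)))))
                     (countN-*ˡ (countN f) g)

  ⟨⟩-≡0-column : ∀ {n} (f : Fin n → ℕ) H g → ⟨ f ∣ H ∣ g ⟩ ≡ 0 → ∀ {p} → g p ≢ 0 → countN (λ k → f k * H k p) ≡ 0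
  ⟨⟩-≡0-column f H g form≡0 {p} gₚ≢0 =
    m*n≡0⇒m≡0 _ (g p) {{≢-nonZero gₚ≢0}} (countN≡0⇒≡0 (λ p → countN (λ k → f k * H k p) * g p) form≡0 p)

  ⟨⟩-≡0 : ∀ {n} (f : Fin n → ℕ) H g → ⟨ f ∣ H ∣ g ⟩ ≡ 0 → ∀ {k p} → f k ≢ 0 → g p ≢ 0 → H k p ≡ 0
  ⟨⟩-≡0 f H g form≡0 {k} {p} fₖ≢0 gₚ≢0 =
    m*n≡0⇒m≡0 (H k p) (f k) {{≢-nonZero fₖ≢0}}
      (trans (*-comm (H k p) (f k)) (countN≡0⇒≡0 (λ k → f k * H k p) (⟨⟩-≡0-column f H g form≡0 gₚ≢0) k))

  ⟨⟩-≢0 : ∀ {n} (f : Fin n → ℕ) H g → ⟨ f ∣ H ∣ g ⟩ ≢ 0 → ∃[ k ] ∃[ p ] f k ≢ 0 × H k p ≢ 0 × g p ≢ 0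
  ⟨⟩-≢0 f H g form≢0 with countN≢0⇒∃≢0 (λ p → countN (λ k → f k * H k p) * g p) form≢0
  ... | p , term≢0 with countN≢0⇒∃≢0 (λ k → f k * H k p) (λ column≡0 → term≢0 (cong (_* g p) column≡0))
  ...   | k , fH≢0 = let (fₖ≢0 , Hₖₚ≢0) = m*n≢0⇒≢0 (f k) (H k p) fH≢0
                   in k , p , fₖ≢0 , Hₖₚ≢0 , proj₂ (m*n≢0⇒≢0 (countN (λ k → f k * H k p)) (g p) term≢0)

  ⟨⟩-even : ∀ {n} (f : Fin n → ℕ) H → (∀ k p → H k p ≡ H p k) → (∀ k → H k k ≡ 0) → ∃[ m ] ⟨ f ∣ H ∣ f ⟩ ≡ m + m
  ⟨⟩-even f H H-sym H-diag with countN²-even (λ p k → f k * H k p * f p)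
                               (λ p k → trans (cong (λ h → f k * h * f p) (H-sym k p)) (*-reverse (f k) (H p k) (f p)))
                               (λ p → trans (cong (λ h → f p * h * f p) (H-diag p)) (cong (_* f p) (*-zeroʳ (f p))))
  ... | m , even = m , trans (countN-cong (λ p → sym (countN-*ʳ (f p) (λ k → f k * H k p)))) even

  ⟨⟩-cong : ∀ {n} (f : Fin n → ℕ) {H K} g → (∀ k p → H k p ≡ K k p) → ⟨ f ∣ H ∣ g ⟩ ≡ ⟨ f ∣ K ∣ g ⟩
  ⟨⟩-cong f g H≗K = countN-cong (λ p → cong (_* g p) (countN-cong (λ k → cong (f k *_) (H≗K k p))))

module SignedGraphs where
  open import Data.Nat.Base using (_+_; _*_)
  open import Data.Nat.Properties using (1+n≢0)
  open Forms

  A⁺ A⁻ Ā : ∀ {n} → SGraph n → Fin n → Fin n → ℕ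
  A⁺ G i j = isPos (G i j)
  A⁻ G i j = isNeg (G i j)
  Ā G i j with i ≟ j | G i j
  ... | yes _ | _    = 0
  ... | no  _ | none = 1
  ... | no  _ | _    = 0

  module _ {n} {G : SGraph n} (graph : IsSignedGraph G) where
    private
      G-sym = proj₁ graph
      loopless = proj₂ graph

    partition : ∀ i j → δ i j + A⁺ G i j + A⁻ G i j + Ā G i j ≡ 1
    partition i j with i ≟ j | G i j in eq
    ... | yes refl | none = refl
    ... | yes refl | pos  = ⊥-elim (pos≢none (trans (sym eq) (loopless i)))
    ... | yes refl | neg  = ⊥-elim (neg≢none (trans (sym eq) (loopless i)))
    ... | no _ | none = refl
    ... | no _ | pos  = refl
    ... | no _ | neg  = refl

    A⁺-sym : ∀ i j → A⁺ G i j ≡ A⁺ G j i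
    A⁺-sym i j = cong isPos (G-sym i j)

    A⁻-sym : ∀ i j → A⁻ G i j ≡ A⁻ G j i
    A⁻-sym i j = cong isNeg (G-sym i j)

    A⁻-diag : ∀ i → A⁻ G i i ≡ 0
    A⁻-diag i = cong isNeg (loopless i)

    pos⇒≢ : ∀ {i j} → G i j ≡ pos → i ≢ j
    pos⇒≢ {i} ij refl = pos≢none (trans (sym ij) (loopless i))

    neg⇒≢ : ∀ {i j} → G i j ≡ neg → i ≢ j
    neg⇒≢ {i} ij refl = neg≢none (trans (sym ij) (loopless i))

  isPos-idem : ∀ e → isPos e * isPos e ≡ isPos e
  isPos-idem none = refl
  isPos-idem pos  = refl
  isPos-idem neg  = refl

  isNeg-idem : ∀ e → isNeg e * isNeg e ≡ isNeg e
  isNeg-idem none = refl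
  isNeg-idem pos  = refl
  isNeg-idem neg  = refl

  isPos≢0⇒pos : ∀ {e} → isPos e ≢ 0 → e ≡ pos
  isPos≢0⇒pos {none} ≢0 = ⊥-elim (≢0 refl)
  isPos≢0⇒pos {pos}  ≢0 = refl
  isPos≢0⇒pos {neg}  ≢0 = ⊥-elim (≢0 refl)

  isNeg≢0⇒neg : ∀ {e} → isNeg e ≢ 0 → e ≡ neg
  isNeg≢0⇒neg {none} ≢0 = ⊥-elim (≢0 refl)
  isNeg≢0⇒neg {pos}  ≢0 = ⊥-elim (≢0 refl)
  isNeg≢0⇒neg {neg}  ≢0 = refl

  pos⇒isPos≢0 : ∀ {e} → e ≡ pos → isPos e ≢ 0
  pos⇒isPos≢0 refl ()

  neg⇒isNeg≢0 : ∀ {e} → e ≡ neg → isNeg e ≢ 0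
  neg⇒isNeg≢0 refl ()

  adjacent⇒pos : ∀ {e} → e ≢ none → isNeg e ≡ 0 → e ≡ pos
  adjacent⇒pos {none} e≢none _ = ⊥-elim (e≢none refl)
  adjacent⇒pos {pos}  _      _ = refl

  adjacent⇒neg : ∀ {e} → e ≢ none → isPos e ≡ 0 → e ≡ neg
  adjacent⇒neg {none} e≢none _ = ⊥-elim (e≢none refl)
  adjacent⇒neg {neg}  _      _ = refl

  Ā≢0⇒non-adjacent : ∀ {n} (G : SGraph n) {i j} → Ā G i j ≢ 0 → i ≢ j × G i j ≡ none
  Ā≢0⇒non-adjacent G {i} {j} ≢0 with i ≟ j | G i j
  ... | yes _   | _    = ⊥-elim (≢0 refl)
  ... | no  i≢j | none = i≢j , refl
  ... | no  _   | pos  = ⊥-elim (≢0 refl)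
  ... | no  _   | neg  = ⊥-elim (≢0 refl)

  Ā≡0⇒adjacent : ∀ {n} (G : SGraph n) {i j} → Ā G i j ≡ 0 → i ≢ j → Adjacent G i j
  Ā≡0⇒adjacent G {i} {j} ≡0 i≢j with i ≟ j | G i j
  ... | yes i≡j | _    = ⊥-elim (i≢j i≡j)
  ... | no  _   | none = λ _ → 1+n≢0 ≡0
  ... | no  _   | pos  = λ ()
  ... | no  _   | neg  = λ ()

  module _ {n} {G : SGraph n} (graph : IsSignedGraph G) where
    open NatSums using (countN-cong; countN-const; countN-distrib-+; countN-δ-row)
    open import Data.Nat.Properties using (*-identityʳ)

    ⟨⟩-partition : (f : Fin n → ℕ) → (∀ p → f p * f p ≡ f p) →
                   countN f + ⟨ f ∣ A⁺ G ∣ f ⟩ + ⟨ f ∣ A⁻ G ∣ f ⟩ + ⟨ f ∣ Ā G ∣ f ⟩ ≡ countN f * countN f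
    ⟨⟩-partition f idem = begin
      countN f + ⟨ f ∣ A⁺ G ∣ f ⟩ + ⟨ f ∣ A⁻ G ∣ f ⟩ + ⟨ f ∣ Ā G ∣ f ⟩
        ≡⟨ cong (λ d → d + ⟨ f ∣ A⁺ G ∣ f ⟩ + ⟨ f ∣ A⁻ G ∣ f ⟩ + ⟨ f ∣ Ā G ∣ f ⟩)
                (sym (trans (⟨⟩-δ f f) (countN-cong idem))) ⟩
      ⟨ f ∣ δ ∣ f ⟩ + ⟨ f ∣ A⁺ G ∣ f ⟩ + ⟨ f ∣ A⁻ G ∣ f ⟩ + ⟨ f ∣ Ā G ∣ f ⟩
        ≡⟨ sym (trans (⟨⟩-distrib-+ f _ (Ā G) f)
                 (cong (_+ ⟨ f ∣ Ā G ∣ f ⟩) (trans (⟨⟩-distrib-+ f _ (A⁻ G) f)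
                   (cong (_+ ⟨ f ∣ A⁻ G ∣ f ⟩) (⟨⟩-distrib-+ f δ (A⁺ G) f))))) ⟩
      ⟨ f ∣ (λ k p → δ k p + A⁺ G k p + A⁻ G k p + Ā G k p) ∣ f ⟩
        ≡⟨ ⟨⟩-cong f f (partition graph) ⟩
      ⟨ f ∣ (λ _ _ → 1) ∣ f ⟩
        ≡⟨ ⟨⟩-one f f ⟩
      countN f * countN f ∎
      where open ≡-Reasoning

    order : ∀ i → n ≡ 1 + posDeg G i + negDeg G i + countN (Ā G i)
    order i = begin
      n                                                                  ≡⟨ sym (*-identityʳ n) ⟩
      n * 1                                                              ≡⟨ sym (countN-const {n} 1) ⟩
      countN {n} (λ _ → 1)                                               ≡⟨ sym (countN-cong (partition graph i)) ⟩
      countN (λ j → δ i j + A⁺ G i j + A⁻ G i j + Ā G i j)               ≡⟨ split ⟩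
      countN (δ i) + posDeg G i + negDeg G i + countN (Ā G i)            ≡⟨ cong (λ d → d + posDeg G i + negDeg G i + countN (Ā G i))
                                                                                 (countN-δ-row i) ⟩
      1 + posDeg G i + negDeg G i + countN (Ā G i)                       ∎
      where
      open ≡-Reasoning
      split = trans (countN-distrib-+ (λ j → δ i j + A⁺ G i j + A⁻ G i j) (Ā G i))
                (cong (_+ countN (Ā G i)) (trans (countN-distrib-+ (λ j → δ i j + A⁺ G i j) (A⁻ G i))
                  (cong (_+ negDeg G i) (countN-distrib-+ (δ i) (A⁺ G i)))))

module Squares where
  open import Data.Nat.Base as ℕ using ()
  open import Data.Nat.Properties using () renaming (*-identityʳ to ℕ*-identityʳ)
  open import Data.Integer.Base using (_+_; _-_; _*_)
  open import Data.Integer.Properties hiding (_≟_)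
  open import Data.Integer.Tactic.RingSolver using (solve-∀)
  open IntSums
  open Matrices
  open Forms
  open SignedGraphs

  entry-split : ∀ e → entry e ≡ + isPos e - + isNeg e
  entry-split none = refl
  entry-split pos  = refl
  entry-split neg  = refl

  module _ {n} (G : SGraph n) where
    A²-expansion : ∀ i j → A² G i j ≡ + (A⁺ G ⊙ A⁺ G) i j - + (A⁺ G ⊙ A⁻ G) i j
                                      - + (A⁻ G ⊙ A⁺ G) i j + + (A⁻ G ⊙ A⁻ G) i j
    A²-expansion i j =
      trans (∑-cong (λ k → product (G i k) (G k j)))
            (∑-signed (λ k → A⁺ G i k ℕ.* A⁺ G k j) (λ k → A⁺ G i k ℕ.* A⁻ G k j)
                      (λ k → A⁻ G i k ℕ.* A⁺ G k j) (λ k → A⁻ G i k ℕ.* A⁻ G k j))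
      where
      product : ∀ e₁ e₂ → entry e₁ * entry e₂ ≡ + (isPos e₁ ℕ.* isPos e₂) - + (isPos e₁ ℕ.* isNeg e₂)
                                                 - + (isNeg e₁ ℕ.* isPos e₂) + + (isNeg e₁ ℕ.* isNeg e₂)
      product none none = refl
      product none pos  = refl
      product none neg  = refl
      product pos  none = refl
      product pos  pos  = refl
      product pos  neg  = refl
      product neg  none = refl
      product neg  pos  = refl
      product neg  neg  = refl

    private
      diagonal : ∀ r a b c → r ≡ (r - c) * + 1 + (a - c) * + 0 + (b - c) * + 0 + c
      diagonal = solve-∀
      positive : ∀ r a b c → a ≡ (r - c) * + 0 + (a - c) * + 1 + (b - c) * + 0 + c
      positive = solve-∀
      negative : ∀ r a b c → b ≡ (r - c) * + 0 + (a - c) * + 0 + (b - c) * + 1 + c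
      negative = solve-∀
      non-edge : ∀ r a b c → c ≡ (r - c) * + 0 + (a - c) * + 0 + (b - c) * + 0 + c
      non-edge = solve-∀

    A²-weighted : ∀ v (g : Fin n → ℕ) →
                  ∑ (λ p → A² G v p * + g p) ≡ + ⟨ A⁺ G v ∣ A⁺ G ∣ g ⟩ - + ⟨ A⁺ G v ∣ A⁻ G ∣ g ⟩
                                                - + ⟨ A⁻ G v ∣ A⁺ G ∣ g ⟩ + + ⟨ A⁻ G v ∣ A⁻ G ∣ g ⟩
    A²-weighted v g =
      trans (∑-cong (λ p → trans (cong (_* + g p) (A²-expansion v p))
                                 (scale ((A⁺ G ⊙ A⁺ G) v p) ((A⁺ G ⊙ A⁻ G) v p)
                                        ((A⁻ G ⊙ A⁺ G) v p) ((A⁻ G ⊙ A⁻ G) v p) (g p))))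
            (∑-signed (λ p → (A⁺ G ⊙ A⁺ G) v p ℕ.* g p) (λ p → (A⁺ G ⊙ A⁻ G) v p ℕ.* g p)
                      (λ p → (A⁻ G ⊙ A⁺ G) v p ℕ.* g p) (λ p → (A⁻ G ⊙ A⁻ G) v p ℕ.* g p))
      where
      distribute : ∀ a b c d g → (a - b - c + d) * g ≡ a * g - b * g - c * g + d * g
      distribute = solve-∀
      scale : ∀ a b c d g → (+ a - + b - + c + + d) * + g ≡ + (a ℕ.* g) - + (b ℕ.* g) - + (c ℕ.* g) + + (d ℕ.* g)
      scale a b c d g = trans (distribute (+ a) (+ b) (+ c) (+ d) (+ g))
                              (sym (cong₂ _+_ (cong₂ _-_ (cong₂ _-_ (pos-* a g) (pos-* b g)) (pos-* c g)) (pos-* d g)))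

    A-row : ∀ {ρ} → NetRegular G ρ → ∀ i → ∑ (A G i) ≡ ρ
    A-row net i =
      trans (∑-cong (λ k → entry-split (G i k)))
            (trans (∑-distrib-- (λ k → + A⁺ G i k) (λ k → + A⁻ G i k))
                   (trans (cong₂ _-_ (∑-countN (A⁺ G i)) (∑-countN (A⁻ G i))) (net i)))

    ∙-⊙ : ∀ (M N : Fin n → Fin n → ℕ) i j → ((λ k l → + M k l) ∙ (λ k l → + N k l)) i j ≡ + (M ⊙ N) i j
    ∙-⊙ M N i j = trans (∑-cong (λ k → sym (pos-* (M i k) (N k j)))) (∑-countN (λ k → M i k ℕ.* N k j))

    A²-lincomb : IsSignedGraph G → ∀ {r a b c} → IsSRSG G r a b c →
                 ∀ i j → A² G i j ≡ (+ r - c) * + δ i j + (a - c) * + A⁺ G i j + (b - c) * + A⁻ G i j + c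
    A²-lincomb (_ , loopless) {r} {a} {b} {c} (_ , _ , on-diagonal , on-pos , on-neg , on-none) i j with i ≟ j
    ... | yes refl rewrite loopless i = trans (on-diagonal i) (diagonal (+ r) a b c)
    ... | no i≢j with G i j in eq
    ...   | none = trans (on-none i j i≢j eq) (non-edge (+ r) a b c)
    ...   | pos  = trans (on-pos i j eq) (positive (+ r) a b c)
    ...   | neg  = trans (on-neg i j eq) (negative (+ r) a b c)

    A⁺A⁻-commute : IsSignedGraph G → ∀ {r a b c ρ} → IsSRSG G r a b c → NetRegular G ρ → + 2 * c ≢ a + b →
                   ∀ i j → (A⁺ G ⊙ A⁻ G) i j ≡ (A⁻ G ⊙ A⁺ G) i j
    A⁺A⁻-commute graph {r} {a} {b} {c} {ρ} srsg net 2c≢a+b i j = +-injective (begin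
      + (A⁺ G ⊙ A⁻ G) i j  ≡⟨ sym (∙-⊙ (A⁺ G) (A⁻ G) i j) ⟩
      (X ∙ Y) i j          ≡⟨ parts-commute X Y (+ r - c) (a - c) (b - c) c rows columns square β+γ≢0 i j ⟩
      (Y ∙ X) i j          ≡⟨ ∙-⊙ (A⁻ G) (A⁺ G) i j ⟩
      + (A⁻ G ⊙ A⁺ G) i j  ∎)
      where
      open ≡-Reasoning
      X Y : Matrix n
      X k l = + A⁺ G k l
      Y k l = + A⁻ G k l
      rows : ∀ k → ∑ (λ l → X k l - Y k l) ≡ ρ
      rows k = trans (∑-cong (λ l → sym (entry-split (G k l)))) (A-row net k)
      columns : ∀ l → ∑ (λ k → X k l - Y k l) ≡ ρ
      columns l = trans (∑-cong (λ k → cong (λ e → + isPos e - + isNeg e) (proj₁ graph k l))) (rows l)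
      square : ∀ k l → ((λ k l → X k l - Y k l) ∙ (λ k l → X k l - Y k l)) k l
                       ≡ (+ r - c) * + δ k l + (a - c) * X k l + (b - c) * Y k l + c
      square k l = trans (∙-cong (λ k m → sym (entry-split (G k m))) (λ m l → sym (entry-split (G m l))) k l)
                         (A²-lincomb graph srsg k l)
      regroup : ∀ a b c → a + b - + 2 * c ≡ (a - c) + (b - c)
      regroup = solve-∀
      β+γ≢0 : (a - c) + (b - c) ≢ + 0
      β+γ≢0 β+γ≡0 = 2c≢a+b (sym (i-j≡0⇒i≡j (a + b) (+ 2 * c) (trans (regroup a b c) β+γ≡0)))

    A²-row : ∀ {ρ} → NetRegular G ρ → ∀ i → ∑ (A² G i) ≡ ρ * ρ
    A²-row {ρ} net i = begin
      ∑ (λ j → ∑ (λ k → A G i k * A G k j))  ≡⟨ ∑-swap (λ j k → A G i k * A G k j) ⟩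
      ∑ (λ k → ∑ (λ j → A G i k * A G k j))  ≡⟨ ∑-cong (λ k → trans (∑-*ˡ (A G i k) (A G k)) (cong (A G i k *_) (A-row net k))) ⟩
      ∑ (λ k → A G i k * ρ)                  ≡⟨ ∑-*ʳ ρ (A G i) ⟩
      ∑ (A G i) * ρ                          ≡⟨ cong (_* ρ) (A-row net i) ⟩
      ρ * ρ                                  ∎
      where open ≡-Reasoning

    A²-row-lincomb : IsSignedGraph G → ∀ {r a b c} → IsSRSG G r a b c → ∀ i →
                     ∑ (A² G i) ≡ (+ r - c) * + 1 + (a - c) * + posDeg G i + (b - c) * + negDeg G i + c * + n
    A²-row-lincomb graph {r} {a} {b} {c} srsg i = begin
      ∑ (A² G i)
        ≡⟨ ∑-cong (λ j → trans (A²-lincomb graph srsg i j)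
                                   (cong (_+_ ((+ r - c) * + δ i j + (a - c) * + A⁺ G i j + (b - c) * + A⁻ G i j)) (sym (*-identityʳ c)))) ⟩
      ∑ (λ j → (+ r - c) * + δ i j + (a - c) * + A⁺ G i j + (b - c) * + A⁻ G i j + c * + 1)
        ≡⟨ ∑-lincomb (+ r - c) (a - c) (b - c) c (λ j → + δ i j) (λ j → + A⁺ G i j) (λ j → + A⁻ G i j) (λ _ → + 1) ⟩
      (+ r - c) * ∑ (λ j → + δ i j) + (a - c) * ∑ (λ j → + A⁺ G i j) + (b - c) * ∑ (λ j → + A⁻ G i j) + c * ∑ {n} (λ _ → + 1)
        ≡⟨ cong₂ (λ d e → (+ r - c) * d + (a - c) * ∑ (λ j → + A⁺ G i j) + (b - c) * ∑ (λ j → + A⁻ G i j) + c * e)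
                 (trans (∑-countN (δ i)) (cong +_ (NatSums.countN-δ-row i)))
                 (trans (∑-countN {n} (λ _ → 1)) (cong +_ (trans (NatSums.countN-const {n} 1) (ℕ*-identityʳ n)))) ⟩
      (+ r - c) * + 1 + (a - c) * ∑ (λ j → + A⁺ G i j) + (b - c) * ∑ (λ j → + A⁻ G i j) + c * + n
        ≡⟨ cong₂ (λ d e → (+ r - c) * + 1 + (a - c) * d + (b - c) * e + c * + n) (∑-countN (A⁺ G i)) (∑-countN (A⁻ G i)) ⟩
      (+ r - c) * + 1 + (a - c) * + posDeg G i + (b - c) * + negDeg G i + c * + n ∎
      where open ≡-Reasoning

    ⟨⟩-commute : ∀ {v} → (∀ p → (A⁺ G ⊙ A⁻ G) v p ≡ (A⁻ G ⊙ A⁺ G) v p) →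
                 ∀ g → ⟨ A⁺ G v ∣ A⁻ G ∣ g ⟩ ≡ ⟨ A⁻ G v ∣ A⁺ G ∣ g ⟩
    ⟨⟩-commute commute g = NatSums.countN-cong (λ p → cong (ℕ._* g p) (commute p))

    A²-positive-weighted : ∀ {r a b c} → IsSRSG G r a b c →
                           ∀ v → ∑ (λ p → A² G v p * + A⁺ G v p) ≡ a * + posDeg G v
    A²-positive-weighted {a = a} (_ , _ , _ , on-pos , _ , _) v =
      trans (∑-cong term) (trans (∑-*ˡ a (λ p → + A⁺ G v p)) (cong (a *_) (∑-countN (A⁺ G v))))
      where
      term : ∀ p → A² G v p * + A⁺ G v p ≡ a * + A⁺ G v p
      term p with G v p in eq
      ... | pos  = cong (_* + 1) (on-pos v p eq)
      ... | none = trans (*-zeroʳ (A² G v p)) (sym (*-zeroʳ a))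
      ... | neg  = trans (*-zeroʳ (A² G v p)) (sym (*-zeroʳ a))

    A²-negative-weighted : ∀ {r a b c} → IsSRSG G r a b c →
                           ∀ v → ∑ (λ p → A² G v p * + A⁻ G v p) ≡ b * + negDeg G v
    A²-negative-weighted {b = b} (_ , _ , _ , _ , on-neg , _) v =
      trans (∑-cong term) (trans (∑-*ˡ b (λ p → + A⁻ G v p)) (cong (b *_) (∑-countN (A⁻ G v))))
      where
      term : ∀ p → A² G v p * + A⁻ G v p ≡ b * + A⁻ G v p
      term p with G v p in eq
      ... | neg  = cong (_* + 1) (on-neg v p eq)
      ... | none = trans (*-zeroʳ (A² G v p)) (sym (*-zeroʳ b))
      ... | pos  = trans (*-zeroʳ (A² G v p)) (sym (*-zeroʳ b))

    module Neighbourhood (graph : IsSignedGraph G) {r a b c} (srsg : IsSRSG G r a b c) (v : Fin n)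
                         (commute : ∀ p → (A⁺ G ⊙ A⁻ G) v p ≡ (A⁻ G ⊙ A⁺ G) v p) where
      open ≡-Reasoning

      x y : Fin n → ℕ
      x = A⁺ G v
      y = A⁻ G v

      positive-equation : + ⟨ x ∣ A⁺ G ∣ x ⟩ - + ⟨ x ∣ A⁻ G ∣ x ⟩ - + ⟨ x ∣ A⁻ G ∣ x ⟩ + + ⟨ y ∣ A⁺ G ∣ y ⟩
                          ≡ a * + posDeg G v
      positive-equation = begin
        + ⟨ x ∣ A⁺ G ∣ x ⟩ - + ⟨ x ∣ A⁻ G ∣ x ⟩ - + ⟨ x ∣ A⁻ G ∣ x ⟩ + + ⟨ y ∣ A⁺ G ∣ y ⟩
          ≡⟨ cong₂ (λ u w → + ⟨ x ∣ A⁺ G ∣ x ⟩ - + ⟨ x ∣ A⁻ G ∣ x ⟩ - + u + + w)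
                   (⟨⟩-commute commute x)
                   (sym (trans (⟨⟩-sym y (A⁻ G) x (A⁻-sym graph)) (⟨⟩-commute commute y))) ⟩
        + ⟨ x ∣ A⁺ G ∣ x ⟩ - + ⟨ x ∣ A⁻ G ∣ x ⟩ - + ⟨ y ∣ A⁺ G ∣ x ⟩ + + ⟨ y ∣ A⁻ G ∣ x ⟩
          ≡⟨ sym (A²-weighted v x) ⟩
        ∑ (λ p → A² G v p * + x p)
          ≡⟨ A²-positive-weighted srsg v ⟩
        a * + posDeg G v ∎

      negative-equation : + ⟨ x ∣ A⁻ G ∣ x ⟩ - + ⟨ y ∣ A⁺ G ∣ y ⟩ - + ⟨ y ∣ A⁺ G ∣ y ⟩ + + ⟨ y ∣ A⁻ G ∣ y ⟩
                          ≡ b * + negDeg G v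
      negative-equation = begin
        + ⟨ x ∣ A⁻ G ∣ x ⟩ - + ⟨ y ∣ A⁺ G ∣ y ⟩ - + ⟨ y ∣ A⁺ G ∣ y ⟩ + + ⟨ y ∣ A⁻ G ∣ y ⟩
          ≡⟨ cong₂ (λ u w → + u - + w - + ⟨ y ∣ A⁺ G ∣ y ⟩ + + ⟨ y ∣ A⁻ G ∣ y ⟩)
                   (sym (trans (⟨⟩-sym x (A⁺ G) y (A⁺-sym graph)) (sym (⟨⟩-commute commute x))))
                   (sym (⟨⟩-commute commute y)) ⟩
        + ⟨ x ∣ A⁺ G ∣ y ⟩ - + ⟨ x ∣ A⁻ G ∣ y ⟩ - + ⟨ y ∣ A⁺ G ∣ y ⟩ + + ⟨ y ∣ A⁻ G ∣ y ⟩
          ≡⟨ sym (A²-weighted v y) ⟩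
        ∑ (λ p → A² G v p * + y p)
          ≡⟨ A²-negative-weighted srsg v ⟩
        b * + negDeg G v ∎

module Arithmetic where
  open import Data.Nat.Base using (_+_)
  open import Data.Nat.Properties using (+-assoc)
  open import Data.Integer.Properties using (+-injective; pos-+)
  open import Data.Integer.Tactic.RingSolver using (solve-∀)

  signed-sum⇒ℕ : ∀ a b c d {m} → + a ℤ.- + b ℤ.- + c ℤ.+ + d ≡ + m → d + a ≡ m + b + c
  signed-sum⇒ℕ a b c d {m} eq = +-injective (begin
    + (d + a)                                                 ≡⟨ pos-+ d a ⟩
    + d ℤ.+ + a                                               ≡⟨ move (+ a) (+ b) (+ c) (+ d) ⟩
    (+ a ℤ.- + b ℤ.- + c ℤ.+ + d) ℤ.+ (+ b ℤ.+ + c)           ≡⟨ cong (ℤ._+ (+ b ℤ.+ + c)) eq ⟩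
    + m ℤ.+ (+ b ℤ.+ + c)                                     ≡⟨ sym (cong (ℤ._+_ (+ m)) (pos-+ b c)) ⟩
    + m ℤ.+ + (b + c)                                         ≡⟨ sym (pos-+ m (b + c)) ⟩
    + (m + (b + c))                                           ≡⟨ cong +_ (sym (+-assoc m b c)) ⟩
    + (m + b + c)                                             ∎)
    where
    open ≡-Reasoning
    move : ∀ a b c d → d ℤ.+ a ≡ (a ℤ.- b ℤ.- c ℤ.+ d) ℤ.+ (b ℤ.+ c)
    move = solve-∀

  arithmetic-3-1 : ∀ {p⁺ p⁻ p⁰ n⁺ n⁻ n⁰} →
                   n⁺ + p⁺ ≡ 12 + p⁻ + p⁻ → n⁻ + p⁻ ≡ 2 + n⁺ + n⁺ →
                   4 + p⁺ + p⁻ + p⁰ ≡ 16 → 2 + n⁺ + n⁻ + n⁰ ≡ 4 →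
                   p⁻ ≡ 0 × n⁺ ≡ 0 × p⁰ ≡ 0 × n⁰ ≡ 0
  arithmetic-3-1 {n⁺ = 0} {n⁻ = 2} {n⁰ = 0} refl refl refl refl = refl , refl , refl , refl
  arithmetic-3-1 {n⁺ = 0} {n⁻ = 1} {n⁰ = 1} refl refl () refl
  arithmetic-3-1 {n⁺ = 0} {n⁻ = 0} {n⁰ = 2} refl refl () refl
  arithmetic-3-1 {n⁺ = 1} {n⁻ = 1} {n⁰ = 0} refl refl () refl
  arithmetic-3-1 {n⁺ = 1} {n⁻ = 0} {n⁰ = 1} refl refl () refl
  arithmetic-3-1 {n⁺ = 2} {n⁻ = 0} {n⁰ = 0} refl refl () refl

  arithmetic-2-1 : ∀ {p⁺ p⁻ p⁰ n⁺ n⁻ n⁰ m} →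
                   n⁺ + p⁺ ≡ 8 + p⁻ + p⁻ → n⁻ + p⁻ ≡ 2 + n⁺ + n⁺ →
                   4 + p⁺ + p⁻ + p⁰ ≡ 16 → 2 + n⁺ + n⁻ + n⁰ ≡ 4 → p⁻ ≡ m + m →
                   p⁻ ≡ 0 × n⁺ ≡ 0 × p⁰ ≡ 4
  arithmetic-2-1 {n⁺ = 0} {n⁻ = 2} {n⁰ = 0} refl refl refl refl _ = refl , refl , refl
  arithmetic-2-1 {n⁺ = 0} {n⁻ = 1} {n⁰ = 1} {m = 0}           refl refl refl refl ()
  arithmetic-2-1 {n⁺ = 0} {n⁻ = 1} {n⁰ = 1} {m = 1}           refl refl refl refl ()
  arithmetic-2-1 {n⁺ = 0} {n⁻ = 1} {n⁰ = 1} {m = suc (suc _)} refl refl refl refl ()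
  arithmetic-2-1 {n⁺ = 0} {n⁻ = 0} {n⁰ = 2} refl refl () refl _
  arithmetic-2-1 {n⁺ = 1} {n⁻ = 1} {n⁰ = 0} refl refl () refl _
  arithmetic-2-1 {n⁺ = 1} {n⁻ = 0} {n⁰ = 1} refl refl () refl _
  arithmetic-2-1 {n⁺ = 2} {n⁻ = 0} {n⁰ = 0} refl refl () refl _

  degree-split : ∀ {p q} → p + q ≡ 6 → + p ℤ.- + q ≡ + 2 → p ≡ 4 × q ≡ 2
  degree-split {0} refl ()
  degree-split {1} refl ()
  degree-split {2} refl ()
  degree-split {3} refl ()
  degree-split {4} refl refl = refl , refl
  degree-split {5} refl ()
  degree-split {6} refl ()

module Regular-6-NetRegular-2 {n} {G : SGraph n} (graph : IsSignedGraph G) {a b c : ℤ} (srsg : IsSRSG G 6 a b c)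
                (regular : Regular G 6) (net : NetRegular G (+ 2)) (2c≢a+b : + 2 ℤ.* c ≢ a ℤ.+ b) where
  open import Data.Nat.Base using (_+_; _*_)
  open NatSums
  open Forms
  open SignedGraphs
  open Squares
  open Arithmetic

  degrees : ∀ v → posDeg G v ≡ 4 × negDeg G v ≡ 2
  degrees v = degree-split (trans (sym split) (regular v)) (net v)
    where
    split : degree G v ≡ posDeg G v + negDeg G v
    split = trans (countN-cong (λ k → adjacency (G v k))) (countN-distrib-+ (A⁺ G v) (A⁻ G v))
      where
      adjacency : ∀ e → isAdj e ≡ isPos e + isNeg e
      adjacency none = refl
      adjacency pos  = refl
      adjacency neg  = refl

  commute : ∀ i j → (A⁺ G ⊙ A⁻ G) i j ≡ (A⁻ G ⊙ A⁺ G) i j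
  commute = A⁺A⁻-commute G graph srsg net 2c≢a+b

  module Vertex (v : Fin n) where
    open Neighbourhood G graph srsg v (commute v) public

    -- Ordered pairs of positive neighbours of v joined positively, negatively, or not at all;
    -- then the same for negative neighbours.
    p⁺ p⁻ p⁰ n⁺ n⁻ n⁰ : ℕ
    p⁺ = ⟨ x ∣ A⁺ G ∣ x ⟩
    p⁻ = ⟨ x ∣ A⁻ G ∣ x ⟩
    p⁰ = ⟨ x ∣ Ā G ∣ x ⟩
    n⁺ = ⟨ y ∣ A⁺ G ∣ y ⟩
    n⁻ = ⟨ y ∣ A⁻ G ∣ y ⟩
    n⁰ = ⟨ y ∣ Ā G ∣ y ⟩

    positive-pairs : 4 + p⁺ + p⁻ + p⁰ ≡ 16
    positive-pairs = subst (λ d → d + p⁺ + p⁻ + p⁰ ≡ d * d) (proj₁ (degrees v))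
                           (⟨⟩-partition graph x (λ p → isPos-idem (G v p)))

    negative-pairs : 2 + n⁺ + n⁻ + n⁰ ≡ 4
    negative-pairs = subst (λ d → d + n⁺ + n⁻ + n⁰ ≡ d * d) (proj₂ (degrees v))
                           (⟨⟩-partition graph y (λ p → isNeg-idem (G v p)))

module Enumerations where
  open import Data.Nat.Base using (_+_)

  record Enumeration {n} (P : Fin n → Set) (m : ℕ) : Set where
    field
      index     : Fin m → Fin n
      injective : ∀ {i j} → index i ≡ index j → i ≡ j
      sound     : ∀ i → P (index i)
      complete  : ∀ k → P k → ∃[ i ] index i ≡ k

  module _ {n m} {P : Fin (suc n) → Set} (E : Enumeration (λ k → P (suc k)) m) where
    private module E = Enumeration E

    skip-zero : ¬ P zero → Enumeration P m
    skip-zero ¬P₀ = record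
      { index     = λ i → suc (E.index i)
      ; injective = λ eq → E.injective (suc-injective eq)
      ; sound     = E.sound
      ; complete  = complete
      }
      where
      complete : ∀ k → P k → ∃[ i ] suc (E.index i) ≡ k
      complete zero    P₀ = ⊥-elim (¬P₀ P₀)
      complete (suc k) Pₖ = let (i , eq) = E.complete k Pₖ in i , cong suc eq

    include-zero : P zero → Enumeration P (suc m)
    include-zero P₀ = record
      { index     = index
      ; injective = injective
      ; sound     = sound
      ; complete  = complete
      }
      where
      index : Fin (suc m) → Fin (suc n)
      index zero    = zero
      index (suc i) = suc (E.index i)
      injective : ∀ {i j} → index i ≡ index j → i ≡ j
      injective {zero}  {zero}  _  = refl
      injective {suc i} {suc j} eq = cong suc (E.injective (suc-injective eq))
      sound : ∀ i → P (index i)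
      sound zero    = P₀
      sound (suc i) = E.sound i
      complete : ∀ k → P k → ∃[ i ] index i ≡ k
      complete zero    _  = zero , refl
      complete (suc k) Pₖ = let (i , eq) = E.complete k Pₖ in suc i , cong suc eq

  IsIndicator : ∀ {n} → (Fin n → ℕ) → (Fin n → Set) → Set
  IsIndicator f P = ∀ k → (f k ≡ 0 × ¬ P k) ⊎ (f k ≡ 1 × P k)

  enumerate : ∀ {n m} {P : Fin n → Set} (f : Fin n → ℕ) → IsIndicator f P → countN f ≡ m → Enumeration P m
  enumerate {zero} f _ refl = record { index = λ () ; injective = λ {i} → ⊥-elim (¬Fin0 i) ; sound = λ () ; complete = λ () }
  enumerate {suc n} f indicator count with indicator zero
  ... | inj₁ (f₀≡0 , ¬P₀) =
    skip-zero (enumerate (λ k → f (suc k)) (λ k → indicator (suc k))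
                         (trans (cong (_+ countN (λ k → f (suc k))) (sym f₀≡0)) count))
              ¬P₀
  ... | inj₂ (f₀≡1 , P₀) with trans (cong (_+ countN (λ k → f (suc k))) (sym f₀≡1)) count
  ...   | refl = include-zero (enumerate (λ k → f (suc k)) (λ k → indicator (suc k)) refl) P₀

  insert : ∀ {n m} {P : Fin n → Set} x → ¬ P x → Enumeration P m → Enumeration (λ k → x ≡ k ⊎ P k) (suc m)
  insert {P = P} x ¬Px E = record
    { index     = index
    ; injective = injective
    ; sound     = sound
    ; complete  = complete
    }
    where
    module E = Enumeration E
    index : Fin _ → Fin _
    index zero    = x
    index (suc i) = E.index i
    injective : ∀ {i j} → index i ≡ index j → i ≡ j
    injective {zero}  {zero}  _  = refl
    injective {zero}  {suc j} eq = ⊥-elim (¬Px (subst P (sym eq) (E.sound j)))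
    injective {suc i} {zero}  eq = ⊥-elim (¬Px (subst P eq (E.sound i)))
    injective {suc i} {suc j} eq = cong suc (E.injective eq)
    sound : ∀ i → x ≡ index i ⊎ P (index i)
    sound zero    = inj₁ refl
    sound (suc i) = inj₂ (E.sound i)
    complete : ∀ k → x ≡ k ⊎ P k → ∃[ i ] index i ≡ k
    complete k (inj₁ x≡k) = zero , x≡k
    complete k (inj₂ Pₖ)  = let (i , eq) = E.complete k Pₖ in suc i , eq

module Coordinates {n m} {R S : Fin n → Fin n → Set}
                   (R-equivalence : IsEquivalence R) (S-equivalence : IsEquivalence S)
                   (R∩S⇒≡ : ∀ {x y} → R x y → S x y → x ≡ y)
                   {v₀ : Fin n} (E : Enumerations.Enumeration (S v₀) m)
                   (reach : ∀ x → ∃[ y ] S v₀ y × R x y) where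
  private
    module R = IsEquivalence R-equivalence
    module S = IsEquivalence S-equivalence
    module E = Enumerations.Enumeration E

  coordinate-exists : ∀ x → ∃[ i ] R x (E.index i)
  coordinate-exists x with reach x
  ... | y , v₀Sy , xRy with E.complete y v₀Sy
  ...   | i , refl = i , xRy

  -- Opaque, so that `with` can abstract comparisons of coordinates where they occur in S15edge.
  opaque
    coordinate : Fin n → Fin m
    coordinate x = proj₁ (coordinate-exists x)

    coordinate-spec : ∀ x → R x (E.index (coordinate x))
    coordinate-spec x = proj₂ (coordinate-exists x)

  coordinate-unique : ∀ {x i} → R x (E.index i) → coordinate x ≡ i
  coordinate-unique {x} {i} xRi = E.injective (R∩S⇒≡ (R.trans (R.sym (coordinate-spec x)) xRi)
                                                     (S.trans (S.sym (E.sound (coordinate x))) (E.sound i)))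

  R⇒≡ : ∀ {x y} → R x y → coordinate x ≡ coordinate y
  R⇒≡ {x} {y} xRy = coordinate-unique (R.trans xRy (coordinate-spec y))

  ≡⇒R : ∀ {x y} → coordinate x ≡ coordinate y → R x y
  ≡⇒R {x} {y} eq = R.trans (coordinate-spec x) (R.sym (subst (λ i → R y (E.index i)) (sym eq) (coordinate-spec y)))

module CartesianProduct {n} {G : SGraph n} (graph : IsSignedGraph G)
  (positive-clique : ∀ {v k p} → G v k ≡ pos → G v p ≡ pos → k ≢ p → G k p ≡ pos)
  (negative-clique : ∀ {v k p} → G v k ≡ neg → G v p ≡ neg → k ≢ p → G k p ≡ neg)
  (mixed-path : ∀ {x y} → x ≢ y → G x y ≡ none → ∃[ m ] G x m ≡ pos × G m y ≡ neg) where
  open Enumerations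
  private
    G-sym    = proj₁ graph
    loopless = proj₂ graph

  Joined : Edge → Fin n → Fin n → Set
  Joined s x y = x ≡ y ⊎ G x y ≡ s

  Joined-isEquivalence : ∀ {s} → (∀ {v k p} → G v k ≡ s → G v p ≡ s → k ≢ p → G k p ≡ s) → IsEquivalence (Joined s)
  Joined-isEquivalence {s} clique = record { refl = inj₁ refl ; sym = symmetric ; trans = transitive }
    where
    symmetric : ∀ {x y} → Joined s x y → Joined s y x
    symmetric         (inj₁ x≡y) = inj₁ (sym x≡y)
    symmetric {x} {y} (inj₂ xy)  = inj₂ (trans (G-sym y x) xy)
    transitive : ∀ {x y z} → Joined s x y → Joined s y z → Joined s x z
    transitive (inj₁ refl) yz          = yz
    transitive xy          (inj₁ refl) = xy
    transitive {x} {y} {z} (inj₂ xy) (inj₂ yz) with x ≟ z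
    ... | yes x≡z = inj₁ x≡z
    ... | no  x≢z = inj₂ (clique (trans (G-sym y x) xy) yz x≢z)

  Joined⇒edge : ∀ {s x y} → Joined s x y → x ≢ y → G x y ≡ s
  Joined⇒edge (inj₁ x≡y) x≢y = ⊥-elim (x≢y x≡y)
  Joined⇒edge (inj₂ xy)  _   = xy

  Joined-unique : ∀ {x y} → Joined pos x y → Joined neg x y → x ≡ y
  Joined-unique (inj₁ x≡y) _          = x≡y
  Joined-unique (inj₂ _)   (inj₁ x≡y) = x≡y
  Joined-unique (inj₂ xy⁺) (inj₂ xy⁻) = ⊥-elim (pos≢neg (trans (sym xy⁺) xy⁻))

  blocks-meet : ∀ u w → ∃[ x ] Joined neg x u × Joined pos x w
  blocks-meet u w with u ≟ w
  ... | yes u≡w = u , inj₁ refl , inj₁ u≡w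
  ... | no  u≢w with G u w in eq
  ...   | pos  = u , inj₁ refl , inj₂ eq
  ...   | neg  = w , inj₂ (trans (G-sym w u) eq) , inj₁ refl
  ...   | none = let (m , wm , mu) = mixed-path (λ w≡u → u≢w (sym w≡u)) (trans (G-sym w u) eq)
                 in m , inj₂ mu , inj₂ (trans (G-sym m w) wm)

  private
    ≈⁺-equivalence = Joined-isEquivalence positive-clique
    ≈⁻-equivalence = Joined-isEquivalence negative-clique

    isPos-indicator : ∀ e → (isPos e ≡ 0 × e ≢ pos) ⊎ (isPos e ≡ 1 × e ≡ pos)
    isPos-indicator none = inj₁ (refl , λ ())
    isPos-indicator pos  = inj₂ (refl , refl)
    isPos-indicator neg  = inj₁ (refl , λ ())

    isNeg-indicator : ∀ e → (isNeg e ≡ 0 × e ≢ neg) ⊎ (isNeg e ≡ 1 × e ≡ neg)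
    isNeg-indicator none = inj₁ (refl , λ ())
    isNeg-indicator pos  = inj₁ (refl , λ ())
    isNeg-indicator neg  = inj₂ (refl , refl)

  module _ (v₀ : Fin n) (pos-degree : posDeg G v₀ ≡ 4) (neg-degree : negDeg G v₀ ≡ 2) where
    positive-block : Enumeration (Joined pos v₀) 5
    positive-block = insert v₀ (λ loop → pos≢none (trans (sym loop) (loopless v₀)))
                            (enumerate (λ k → isPos (G v₀ k)) (λ k → isPos-indicator (G v₀ k)) pos-degree)

    negative-block : Enumeration (Joined neg v₀) 3
    negative-block = insert v₀ (λ loop → neg≢none (trans (sym loop) (loopless v₀)))
                            (enumerate (λ k → isNeg (G v₀ k)) (λ k → isNeg-indicator (G v₀ k)) neg-degree)

    row-reach : ∀ x → ∃[ y ] Joined pos v₀ y × Joined neg x y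
    row-reach x with v₀ ≟ x
    ... | yes v₀≡x = v₀ , inj₁ refl , inj₁ (sym v₀≡x)
    ... | no  v₀≢x with G v₀ x in eq
    ...   | pos  = x , inj₂ eq , inj₁ refl
    ...   | neg  = v₀ , inj₁ refl , inj₂ (trans (G-sym x v₀) eq)
    ...   | none = let (m , v₀m , mx) = mixed-path v₀≢x eq in m , inj₂ v₀m , inj₂ (trans (G-sym x m) mx)

    column-reach : ∀ x → ∃[ y ] Joined neg v₀ y × Joined pos x y
    column-reach x with v₀ ≟ x
    ... | yes v₀≡x = v₀ , inj₁ refl , inj₁ (sym v₀≡x)
    ... | no  v₀≢x with G v₀ x in eq
    ...   | neg  = x , inj₂ eq , inj₁ refl
    ...   | pos  = v₀ , inj₁ refl , inj₂ (trans (G-sym x v₀) eq)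
    ...   | none = let (m , xm , mv₀) = mixed-path (λ x≡v₀ → v₀≢x (sym x≡v₀)) (trans (G-sym x v₀) eq)
                   in m , inj₂ (trans (G-sym v₀ m) mv₀) , inj₂ xm

    module Row    = Coordinates ≈⁻-equivalence ≈⁺-equivalence (λ x⁻y x⁺y → Joined-unique x⁺y x⁻y) positive-block row-reach
    module Column = Coordinates ≈⁺-equivalence ≈⁻-equivalence Joined-unique negative-block column-reach

    coordinates : Fin n → Fin 5 × Fin 3
    coordinates x = Row.coordinate x , Column.coordinate x

    coordinates-preserve : ∀ x y → S15edge (coordinates x) (coordinates y) ≡ G x y
    coordinates-preserve x y with Row.coordinate x ≟ Row.coordinate y | Column.coordinate x ≟ Column.coordinate y
    ... | yes same-row | yes same-column =
      sym (subst (λ z → G x z ≡ none) (Joined-unique (Column.≡⇒R same-column) (Row.≡⇒R same-row)) (loopless x))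
    ... | yes same-row | no  other-column = sym (Joined⇒edge (Row.≡⇒R same-row) (other-column ∘ cong Column.coordinate))
    ... | no  other-row | yes same-column = sym (Joined⇒edge (Column.≡⇒R same-column) (other-row ∘ cong Row.coordinate))
    ... | no  other-row | no  other-column with G x y in eq
    ...   | none = refl
    ...   | pos  = ⊥-elim (other-column (Column.R⇒≡ (inj₂ eq)))
    ...   | neg  = ⊥-elim (other-row (Row.R⇒≡ (inj₂ eq)))

    label : Fin n → Fin 15
    label x = combine (Row.coordinate x) (Column.coordinate x)

    label-injective : ∀ {x y} → label x ≡ label y → x ≡ y
    label-injective {x} {y} eq = Joined-unique (Column.≡⇒R (cong proj₂ same)) (Row.≡⇒R (cong proj₁ same))
      where
      same : coordinates x ≡ coordinates y
      same = trans (sym (remQuot-combine (Row.coordinate x) (Column.coordinate x)))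
                   (trans (cong (remQuot 3) eq) (remQuot-combine (Row.coordinate y) (Column.coordinate y)))

    label-surjective : ∀ z → ∃[ x ] label x ≡ z
    label-surjective z with remQuot {5} 3 z in split
    ... | i , j with blocks-meet (Enumeration.index positive-block i) (Enumeration.index negative-block j)
    ...   | x , row , column = x , (begin
      label x                 ≡⟨ cong₂ combine (Row.coordinate-unique {x} {i} row) (Column.coordinate-unique {x} {j} column) ⟩
      combine i j          ≡⟨ cong (uncurry combine) (sym split) ⟩
      uncurry combine (remQuot {5} 3 z) ≡⟨ combine-remQuot {5} 3 z ⟩
      z                    ∎)
      where open ≡-Reasoning

    isomorphic : Isomorphic G S¹₁₅
    isomorphic = mk⤖ (label-injective , strictlySurjective⇒surjective label-surjective)
               , λ x y → trans (cong₂ S15edge (remQuot-combine (Row.coordinate x) (Column.coordinate x))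
                                              (remQuot-combine (Row.coordinate y) (Column.coordinate y)))
                               (coordinates-preserve x y)

module Parameters-3-1 {n} {G : SGraph n} (graph : IsSignedGraph G) {c : ℤ} (srsg : IsSRSG G 6 (+ 3) (+ 1) c)
                (regular : Regular G 6) (net : NetRegular G (+ 2))
                (2c≢a+b : + 2 ℤ.* c ≢ + 3 ℤ.+ + 1) where
  open import Data.Nat.Base using (_*_)
  open import Data.Nat.Properties using (1+n≢0)
  open NatSums
  open Forms
  open SignedGraphs
  open Squares
  open Arithmetic
  open Regular-6-NetRegular-2 graph srsg regular net 2c≢a+b
  open import Data.Integer.Tactic.RingSolver using (solve-∀)
  private
    G-sym       = proj₁ graph
    loopless    = proj₂ graph
    on-non-edge = proj₂ (proj₂ (proj₂ (proj₂ (proj₂ srsg))))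

  local-counts : ∀ v → let open Vertex v in p⁻ ≡ 0 × n⁺ ≡ 0 × p⁰ ≡ 0 × n⁰ ≡ 0
  local-counts v = arithmetic-3-1 (signed-sum⇒ℕ p⁺ p⁻ p⁻ n⁺ positive) (signed-sum⇒ℕ p⁻ n⁺ n⁺ n⁻ negative)
                               positive-pairs negative-pairs
    where
    open Vertex v
    positive : + p⁺ ℤ.- + p⁻ ℤ.- + p⁻ ℤ.+ + n⁺ ≡ + 12
    positive = trans positive-equation (cong (λ d → + 3 ℤ.* + d) (proj₁ (degrees v)))
    negative : + p⁻ ℤ.- + n⁺ ℤ.- + n⁺ ℤ.+ + n⁻ ≡ + 2
    negative = trans negative-equation (cong (λ d → + 1 ℤ.* + d) (proj₂ (degrees v)))

  positive-clique : ∀ {v k p} → G v k ≡ pos → G v p ≡ pos → k ≢ p → G k p ≡ pos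
  positive-clique {v} {k} {p} vk vp k≢p =
    adjacent⇒pos (Ā≡0⇒adjacent G (⟨⟩-≡0 x (Ā G) x p⁰≡0 (pos⇒isPos≢0 vk) (pos⇒isPos≢0 vp)) k≢p)
                 (⟨⟩-≡0 x (A⁻ G) x p⁻≡0 (pos⇒isPos≢0 vk) (pos⇒isPos≢0 vp))
    where
    open Vertex v
    p⁻≡0 = proj₁ (local-counts v)
    p⁰≡0 = proj₁ (proj₂ (proj₂ (local-counts v)))

  negative-clique : ∀ {v k p} → G v k ≡ neg → G v p ≡ neg → k ≢ p → G k p ≡ neg
  negative-clique {v} {k} {p} vk vp k≢p =
    adjacent⇒neg (Ā≡0⇒adjacent G (⟨⟩-≡0 y (Ā G) y n⁰≡0 (neg⇒isNeg≢0 vk) (neg⇒isNeg≢0 vp)) k≢p)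
                 (⟨⟩-≡0 y (A⁺ G) y n⁺≡0 (neg⇒isNeg≢0 vk) (neg⇒isNeg≢0 vp))
    where
    open Vertex v
    n⁺≡0 = proj₁ (proj₂ (local-counts v))
    n⁰≡0 = proj₂ (proj₂ (proj₂ (local-counts v)))

  non-adjacent-square : ∀ {u w} → u ≢ w → G u w ≡ none →
                        A² G u w ≡ ℤ.- (+ (A⁺ G ⊙ A⁻ G) u w ℤ.+ + (A⁺ G ⊙ A⁻ G) u w)
  non-adjacent-square {u} {w} u≢w uw = begin
    A² G u w
      ≡⟨ A²-expansion G u w ⟩
    + (A⁺ G ⊙ A⁺ G) u w ℤ.- + t ℤ.- + (A⁻ G ⊙ A⁺ G) u w ℤ.+ + (A⁻ G ⊙ A⁻ G) u w
      ≡⟨ cong₂ (λ s r → + s ℤ.- + t ℤ.- + r ℤ.+ + (A⁻ G ⊙ A⁻ G) u w) no-positive-walk (sym (commute u w)) ⟩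
    + 0 ℤ.- + t ℤ.- + t ℤ.+ + (A⁻ G ⊙ A⁻ G) u w
      ≡⟨ cong (λ s → + 0 ℤ.- + t ℤ.- + t ℤ.+ + s) no-negative-walk ⟩
    + 0 ℤ.- + t ℤ.- + t ℤ.+ + 0
      ≡⟨ collect (+ t) ⟩
    ℤ.- (+ t ℤ.+ + t) ∎
    where
    open ≡-Reasoning
    t = (A⁺ G ⊙ A⁻ G) u w
    collect : ∀ t → + 0 ℤ.- t ℤ.- t ℤ.+ + 0 ≡ ℤ.- (t ℤ.+ t)
    collect = solve-∀
    no-positive-walk : (A⁺ G ⊙ A⁺ G) u w ≡ 0
    no-positive-walk = ≡0⇒countN≡0 _ (λ m → ¬both≢0⇒m*n≡0 (λ um mw →
      pos≢none (trans (sym (positive-clique (trans (G-sym m u) (isPos≢0⇒pos um)) (isPos≢0⇒pos mw) u≢w)) uw)))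
    no-negative-walk : (A⁻ G ⊙ A⁻ G) u w ≡ 0
    no-negative-walk = ≡0⇒countN≡0 _ (λ m → ¬both≢0⇒m*n≡0 (λ um mw →
      neg≢none (trans (sym (negative-clique (trans (G-sym m u) (isNeg≢0⇒neg um)) (isNeg≢0⇒neg mw) u≢w)) uw)))

  positive-neighbour : ∀ v → ∃[ k ] G v k ≡ pos
  positive-neighbour v with countN≢0⇒∃≢0 (A⁺ G v) (λ d≡0 → 1+n≢0 (trans (sym (proj₁ (degrees v))) d≡0))
  ... | k , vk≢0 = k , isPos≢0⇒pos vk≢0

  negative-neighbour : ∀ v → ∃[ k ] G v k ≡ neg
  negative-neighbour v with countN≢0⇒∃≢0 (A⁻ G v) (λ d≡0 → 1+n≢0 (trans (sym (proj₂ (degrees v))) d≡0))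
  ... | k , vk≢0 = k , isNeg≢0⇒neg vk≢0

  c≡-2 : Fin n → c ≡ ℤ.- + 2
  c≡-2 v₀ = begin
    c                                                     ≡⟨ sym (on-non-edge v₀ w₀ v₀≢w₀ v₀w₀) ⟩
    A² G v₀ w₀                                            ≡⟨ non-adjacent-square v₀≢w₀ v₀w₀ ⟩
    ℤ.- (+ (A⁺ G ⊙ A⁻ G) v₀ w₀ ℤ.+ + (A⁺ G ⊙ A⁻ G) v₀ w₀) ≡⟨ cong (λ t → ℤ.- (+ t ℤ.+ + t)) single-walk ⟩
    ℤ.- + 2                                               ∎
    where
    open ≡-Reasoning
    k₀ = proj₁ (positive-neighbour v₀)
    v₀k₀ = proj₂ (positive-neighbour v₀)
    w₀ = proj₁ (negative-neighbour k₀)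
    k₀w₀ = proj₂ (negative-neighbour k₀)
    v₀≢w₀ : v₀ ≢ w₀
    v₀≢w₀ v₀≡w₀ = pos≢neg (trans (sym (trans (G-sym k₀ v₀) v₀k₀)) (subst (λ z → G k₀ z ≡ neg) (sym v₀≡w₀) k₀w₀))
    v₀w₀ : G v₀ w₀ ≡ none
    v₀w₀ with G v₀ w₀ in eq
    ... | none = refl
    ... | pos  = ⊥-elim (pos≢neg (trans (sym (positive-clique v₀k₀ eq (neg⇒≢ graph k₀w₀))) k₀w₀))
    ... | neg  = ⊥-elim (pos≢neg (trans (sym v₀k₀)
                   (negative-clique (trans (G-sym w₀ v₀) eq) (trans (G-sym w₀ k₀) k₀w₀) (pos⇒≢ graph v₀k₀))))
    single-walk : (A⁺ G ⊙ A⁻ G) v₀ w₀ ≡ 1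
    single-walk = trans (countN-single _ k₀ (λ m m≢k₀ → ¬both≢0⇒m*n≡0 (λ v₀m mw₀ →
                    pos≢neg (trans (sym (positive-clique v₀k₀ (isPos≢0⇒pos v₀m) (λ k₀≡m → m≢k₀ (sym k₀≡m))))
                                   (trans (G-sym k₀ m) (negative-clique (trans (G-sym w₀ m) (isNeg≢0⇒neg mw₀))
                                                                       (trans (G-sym w₀ k₀) k₀w₀) m≢k₀))))))
                        (cong₂ (λ e e′ → isPos e * isNeg e′) v₀k₀ k₀w₀)

  mixed-walk≢0 : ∀ {u w} → u ≢ w → G u w ≡ none → (A⁺ G ⊙ A⁻ G) u w ≢ 0
  mixed-walk≢0 {u} {w} u≢w uw t≡0 = -2≢0 (begin
    ℤ.- + 2                                             ≡⟨ sym (c≡-2 u) ⟩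
    c                                                   ≡⟨ sym (on-non-edge u w u≢w uw) ⟩
    A² G u w                                            ≡⟨ non-adjacent-square u≢w uw ⟩
    ℤ.- (+ (A⁺ G ⊙ A⁻ G) u w ℤ.+ + (A⁺ G ⊙ A⁻ G) u w)   ≡⟨ cong (λ t → ℤ.- (+ t ℤ.+ + t)) t≡0 ⟩
    + 0                                                 ∎)
    where
    open ≡-Reasoning
    -2≢0 : ℤ.- + 2 ≢ + 0
    -2≢0 ()

  mixed-path : ∀ {u w} → u ≢ w → G u w ≡ none → ∃[ m ] G u m ≡ pos × G m w ≡ neg
  mixed-path {u} {w} u≢w uw =
    let (m , walk) = countN≢0⇒∃≢0 (λ m → isPos (G u m) * isNeg (G m w)) (mixed-walk≢0 u≢w uw)
        (um , mw)  = m*n≢0⇒≢0 (isPos (G u m)) (isNeg (G m w)) walk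
    in m , isPos≢0⇒pos um , isNeg≢0⇒neg mw

  isomorphic : Fin n → Isomorphic G S¹₁₅
  isomorphic v₀ = CartesianProduct.isomorphic graph positive-clique negative-clique mixed-path
                                              v₀ (proj₁ (degrees v₀)) (proj₂ (degrees v₀))

module Parameters-2-1 {n} {G : SGraph n} (graph : IsSignedGraph G) {c : ℤ} (srsg : IsSRSG G 6 (+ 2) (+ 1) c)
                (regular : Regular G 6) (net : NetRegular G (+ 2))
                (2c≢a+b : + 2 ℤ.* c ≢ + 2 ℤ.+ + 1) where
  open import Data.Nat.Base using (_+_; _*_; _∸_; _≤_; z≤n; s≤s)
  open import Data.Nat.Properties using (1+n≢0; ≤-refl; ≤-reflexive; ≤-trans; n≤1+n; +-identityʳ; *-identityˡ; *-identityʳ;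
                                         +-cancelʳ-≤; +-cancelˡ-≤; +-monoˡ-≤; +-mono-≤; *-monoʳ-≤; *-distribˡ-+; module ≤-Reasoning)
  import Data.Nat.Tactic.RingSolver as ℕ-Solver
  open import Data.Integer.Properties using (+-injective; pos-+; pos-*; m-n≡m⊖n; ⊖-≥)
  open import Data.Integer.Tactic.RingSolver using (solve-∀)
  open NatSums
  open Forms
  open SignedGraphs
  open Squares
  open Arithmetic
  open Regular-6-NetRegular-2 graph srsg regular net 2c≢a+b
  private
    G-sym       = proj₁ graph
    on-pos      = proj₁ (proj₂ (proj₂ (proj₂ srsg)))
    on-non-edge = proj₂ (proj₂ (proj₂ (proj₂ (proj₂ srsg))))

  local-counts : ∀ v → let open Vertex v in p⁻ ≡ 0 × n⁺ ≡ 0 × p⁰ ≡ 4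
  local-counts v = arithmetic-2-1 {m = proj₁ p⁻-even}
                                 (signed-sum⇒ℕ p⁺ p⁻ p⁻ n⁺ positive) (signed-sum⇒ℕ p⁻ n⁺ n⁺ n⁻ negative)
                                 positive-pairs negative-pairs (proj₂ p⁻-even)
    where
    open Vertex v
    p⁻-even = ⟨⟩-even x (A⁻ G) (A⁻-sym graph) (A⁻-diag graph)
    positive : + p⁺ ℤ.- + p⁻ ℤ.- + p⁻ ℤ.+ + n⁺ ≡ + 8
    positive = trans positive-equation (cong (λ d → + 2 ℤ.* + d) (proj₁ (degrees v)))
    negative : + p⁻ ℤ.- + n⁺ ℤ.- + n⁺ ℤ.+ + n⁻ ≡ + 2
    negative = trans negative-equation (cong (λ d → + 1 ℤ.* + d) (proj₂ (degrees v)))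

  inner-degree : ∀ {v p} → G v p ≡ pos → (A⁺ G ⊙ A⁺ G) v p ≡ 2
  inner-degree {v} {p} vp = +-injective (begin
    + xx                                  ≡⟨ sym (drop-zeros (+ xx)) ⟩
    + xx ℤ.- + 0 ℤ.- + 0 ℤ.+ + 0          ≡⟨ sym (cong₂ (λ s t → + xx ℤ.- + s ℤ.- + t ℤ.+ + 0) xy≡0 yx≡0) ⟩
    + xx ℤ.- + xy ℤ.- + yx ℤ.+ + 0        ≡⟨ sym (cong (λ s → + xx ℤ.- + xy ℤ.- + yx ℤ.+ + s) yy≡0) ⟩
    + xx ℤ.- + xy ℤ.- + yx ℤ.+ + yy       ≡⟨ sym (A²-expansion G v p) ⟩
    A² G v p                              ≡⟨ on-pos v p vp ⟩
    + 2                                   ∎)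
    where
    open ≡-Reasoning
    open Vertex v
    xx xy yx yy : ℕ
    xx = (A⁺ G ⊙ A⁺ G) v p
    xy = (A⁺ G ⊙ A⁻ G) v p
    yx = (A⁻ G ⊙ A⁺ G) v p
    yy = (A⁻ G ⊙ A⁻ G) v p
    drop-zeros : ∀ t → t ℤ.- + 0 ℤ.- + 0 ℤ.+ + 0 ≡ t
    drop-zeros = solve-∀
    p⁻≡0 = proj₁ (local-counts v)
    n⁺≡0 = proj₁ (proj₂ (local-counts v))
    xₚ≢0 = pos⇒isPos≢0 vp
    xy≡0 : xy ≡ 0
    xy≡0 = ⟨⟩-≡0-column x (A⁻ G) x p⁻≡0 xₚ≢0
    yx≡0 : yx ≡ 0
    yx≡0 = ⟨⟩-≡0-column y (A⁺ G) x (trans (sym (⟨⟩-commute G (commute v) x)) p⁻≡0) xₚ≢0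
    yy≡0 : yy ≡ 0
    yy≡0 = ⟨⟩-≡0-column y (A⁻ G) x
             (trans (⟨⟩-sym y (A⁻ G) x (A⁻-sym graph)) (trans (⟨⟩-commute G (commute v) y) n⁺≡0)) xₚ≢0

  non-adjacent-pair : ∀ v → ∃[ q ] ∃[ p ] G v q ≡ pos × G v p ≡ pos × q ≢ p × G q p ≡ none
  non-adjacent-pair v =
    let (q , p , vq , qp , vp) = ⟨⟩-≢0 x (Ā G) x (λ p⁰≡0 → 1+n≢0 (trans (sym (proj₂ (proj₂ (local-counts v)))) p⁰≡0))
        (q≢p , q̸p) = Ā≢0⇒non-adjacent G qp
    in q , p , isPos≢0⇒pos vq , isPos≢0⇒pos vp , q≢p , q̸p
    where open Vertex v

  isPos+isNeg≤1 : ∀ e → isPos e + isNeg e ≤ 1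
  isPos+isNeg≤1 none = z≤n
  isPos+isNeg≤1 pos  = s≤s z≤n
  isPos+isNeg≤1 neg  = s≤s z≤n

  union-bound-at : ∀ e₁ e₂ e₃ → isPos e₁ * (isPos e₂ + isPos e₃ + 0 + 0) ≤ isPos e₁ * isPos e₂ * isPos e₃ + isPos e₁
  union-bound-at none _    _    = z≤n
  union-bound-at neg  _    _    = z≤n
  union-bound-at pos  none none = z≤n
  union-bound-at pos  none pos  = ≤-refl
  union-bound-at pos  none neg  = z≤n
  union-bound-at pos  pos  none = ≤-refl
  union-bound-at pos  pos  pos  = ≤-refl
  union-bound-at pos  pos  neg  = ≤-refl
  union-bound-at pos  neg  none = z≤n
  union-bound-at pos  neg  pos  = ≤-refl
  union-bound-at pos  neg  neg  = z≤n

  common-bound-at : ∀ e₁ e₂ e₃ → isPos e₁ * isPos e₂ * isPos e₃ + 0 ≤ isPos e₂ * isPos e₃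
  common-bound-at none _  _  = z≤n
  common-bound-at neg  _  _  = z≤n
  common-bound-at pos  e₂ e₃ = ≤-reflexive (trans (+-identityʳ _) (cong (_* isPos e₃) (*-identityˡ (isPos e₂))))

  -- q and p each have two positive neighbours among the positive neighbours of v other than p and q;
  -- there are only two of those, so together with v they are three common positive neighbours.
  module NonAdjacentPair {v q p} (vq : G v q ≡ pos) (vp : G v p ≡ pos) (q≢p : q ≢ p) (q̸p : G q p ≡ none) where
    private
      x : Fin n → ℕ
      x = A⁺ G v
      loopless = proj₂ graph

    common-inside : ℕ
    common-inside = countN (λ m → x m * A⁺ G q m * A⁺ G m p)

    incidences : countN (λ m → x m * (A⁺ G q m + A⁺ G m p + δ m p + δ m q)) ≡ 6
    incidences = begin
      countN (λ m → x m * (A⁺ G q m + A⁺ G m p + δ m p + δ m q))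
        ≡⟨ countN-cong (λ m → distribute (x m) (A⁺ G q m) (A⁺ G m p) (δ m p) (δ m q)) ⟩
      countN (λ m → x m * A⁺ G q m + x m * A⁺ G m p + x m * δ m p + x m * δ m q)
        ≡⟨ trans (countN-distrib-+ (λ m → x m * A⁺ G q m + x m * A⁺ G m p + x m * δ m p) (λ m → x m * δ m q))
                 (cong (_+ countN (λ m → x m * δ m q)) (trans (countN-distrib-+ (λ m → x m * A⁺ G q m + x m * A⁺ G m p) (λ m → x m * δ m p))
                   (cong (_+ countN (λ m → x m * δ m p)) (countN-distrib-+ (λ m → x m * A⁺ G q m) (λ m → x m * A⁺ G m p))))) ⟩
      countN (λ m → x m * A⁺ G q m) + (A⁺ G ⊙ A⁺ G) v p + countN (λ m → x m * δ m p) + countN (λ m → x m * δ m q)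
        ≡⟨ cong₂ (λ s t → s + (A⁺ G ⊙ A⁺ G) v p + t + countN (λ m → x m * δ m q))
                 (trans (countN-cong (λ m → cong (x m *_) (A⁺-sym graph q m))) (inner-degree vq))
                 (trans (countN-δ x p) (cong isPos vp)) ⟩
      2 + (A⁺ G ⊙ A⁺ G) v p + 1 + countN (λ m → x m * δ m q)
        ≡⟨ cong₂ (λ s t → 2 + s + 1 + t) (inner-degree vp) (trans (countN-δ x q) (cong isPos vq)) ⟩
      6 ∎
      where
      open ≡-Reasoning
      distribute : ∀ x a b c d → x * (a + b + c + d) ≡ x * a + x * b + x * c + x * d
      distribute = ℕ-Solver.solve-∀

    union-bound : ∀ m → x m * (A⁺ G q m + A⁺ G m p + δ m p + δ m q) ≤ x m * A⁺ G q m * A⁺ G m p + x m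
    union-bound m with m ≟ p | m ≟ q
    ... | yes refl | yes refl = ⊥-elim (q≢p refl)
    ... | yes refl | no  _    rewrite vp | q̸p | loopless m = ≤-refl
    ... | no  _    | yes refl rewrite vq | q̸p | loopless m = ≤-refl
    ... | no  _    | no  _    = union-bound-at (G v m) (G q m) (G m p)

    common-bound : ∀ m → x m * A⁺ G q m * A⁺ G m p + δ m v ≤ A⁺ G q m * A⁺ G m p
    common-bound m with m ≟ v
    ... | yes refl rewrite loopless m | trans (G-sym q m) vq | vp = ≤-refl
    ... | no  _    = common-bound-at (G v m) (G q m) (G m p)

    common-inside≥2 : 2 ≤ common-inside
    common-inside≥2 = +-cancelʳ-≤ 4 2 common-inside (begin
      6                                                           ≡⟨ sym incidences ⟩
      countN (λ m → x m * (A⁺ G q m + A⁺ G m p + δ m p + δ m q))  ≤⟨ countN-mono-≤ union-bound ⟩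
      countN (λ m → x m * A⁺ G q m * A⁺ G m p + x m)              ≡⟨ countN-distrib-+ (λ m → x m * A⁺ G q m * A⁺ G m p) x ⟩
      common-inside + posDeg G v                                  ≡⟨ cong (_+_ common-inside) (proj₁ (degrees v)) ⟩
      common-inside + 4                                           ∎)
      where open ≤-Reasoning

    common≥3 : 3 ≤ (A⁺ G ⊙ A⁺ G) q p
    common≥3 = ≤-trans (+-monoˡ-≤ 1 common-inside≥2) (begin
      common-inside + 1                                 ≡⟨ cong (_+_ common-inside) (sym (trans (countN-cong (λ m → δ-sym m v))
                                                                                                 (countN-δ-row v))) ⟩
      common-inside + countN (λ m → δ m v)              ≡⟨ sym (countN-distrib-+ (λ m → x m * A⁺ G q m * A⁺ G m p) (λ m → δ m v)) ⟩
      countN (λ m → x m * A⁺ G q m * A⁺ G m p + δ m v)  ≤⟨ countN-mono-≤ common-bound ⟩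
      (A⁺ G ⊙ A⁺ G) q p                                 ∎)
      where open ≤-Reasoning

    common+mixed≤4 : (A⁺ G ⊙ A⁺ G) q p + (A⁺ G ⊙ A⁻ G) q p ≤ 4
    common+mixed≤4 = begin
      (A⁺ G ⊙ A⁺ G) q p + (A⁺ G ⊙ A⁻ G) q p                     ≡⟨ sym (countN-distrib-+ (λ m → A⁺ G q m * A⁺ G m p)
                                                                                             (λ m → A⁺ G q m * A⁻ G m p)) ⟩
      countN (λ m → A⁺ G q m * A⁺ G m p + A⁺ G q m * A⁻ G m p)  ≤⟨ countN-mono-≤ at-most-one-edge ⟩
      posDeg G q                                                ≡⟨ proj₁ (degrees q) ⟩
      4                                                         ∎
      where
      open ≤-Reasoning
      at-most-one-edge : ∀ m → A⁺ G q m * A⁺ G m p + A⁺ G q m * A⁻ G m p ≤ A⁺ G q m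
      at-most-one-edge m = ≤-trans (≤-reflexive (sym (*-distribˡ-+ (A⁺ G q m) (A⁺ G m p) (A⁻ G m p))))
                                   (≤-trans (*-monoʳ-≤ (A⁺ G q m) (isPos+isNeg≤1 (G m p))) (≤-reflexive (*-identityʳ (A⁺ G q m))))

    mixed≤1 : (A⁺ G ⊙ A⁻ G) q p ≤ 1
    mixed≤1 = +-cancelˡ-≤ 3 _ 1 (≤-trans (+-monoˡ-≤ ((A⁺ G ⊙ A⁻ G) q p) common≥3) common+mixed≤4)

    c-nonnegative : ∃[ t ] c ≡ + t
    c-nonnegative = α ∸ (β + β) + γ , (begin
      c                                       ≡⟨ sym (on-non-edge q p q≢p q̸p) ⟩
      A² G q p                                ≡⟨ A²-expansion G q p ⟩
      + α ℤ.- + β ℤ.- + (A⁻ G ⊙ A⁺ G) q p ℤ.+ + γ ≡⟨ cong (λ s → + α ℤ.- + β ℤ.- + s ℤ.+ + γ) (sym (commute q p)) ⟩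
      + α ℤ.- + β ℤ.- + β ℤ.+ + γ              ≡⟨ regroup (+ α) (+ β) (+ γ) ⟩
      + α ℤ.- (+ β ℤ.+ + β) ℤ.+ + γ            ≡⟨ cong (λ s → + α ℤ.- s ℤ.+ + γ) (sym (pos-+ β β)) ⟩
      + α ℤ.- + (β + β) ℤ.+ + γ                ≡⟨ cong (ℤ._+ + γ) (trans (m-n≡m⊖n α (β + β)) (⊖-≥ ββ≤α)) ⟩
      + (α ∸ (β + β)) ℤ.+ + γ                  ≡⟨ sym (pos-+ (α ∸ (β + β)) γ) ⟩
      + (α ∸ (β + β) + γ)                      ∎)
      where
      open ≡-Reasoning
      α β γ : ℕ
      α = (A⁺ G ⊙ A⁺ G) q p
      β = (A⁺ G ⊙ A⁻ G) q p
      γ = (A⁻ G ⊙ A⁻ G) q p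
      regroup : ∀ a b g → a ℤ.- b ℤ.- b ℤ.+ g ≡ a ℤ.- (b ℤ.+ b) ℤ.+ g
      regroup = solve-∀
      ββ≤α : β + β ≤ α
      ββ≤α = ≤-trans (+-mono-≤ mixed≤1 mixed≤1) (≤-trans (n≤1+n 2) common≥3)

  row-count : ∀ v → ∑ (A² G v) ≡ (+ 6 ℤ.- c) ℤ.* + 1 ℤ.+ (+ 2 ℤ.- c) ℤ.* + 4 ℤ.+ (+ 1 ℤ.- c) ℤ.* + 2
                                  ℤ.+ c ℤ.* + (7 + countN (Ā G v))
  row-count v = begin
    ∑ (A² G v)
      ≡⟨ A²-row-lincomb G graph srsg v ⟩
    (+ 6 ℤ.- c) ℤ.* + 1 ℤ.+ (+ 2 ℤ.- c) ℤ.* + posDeg G v ℤ.+ (+ 1 ℤ.- c) ℤ.* + negDeg G v ℤ.+ c ℤ.* + n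
      ≡⟨ cong (λ m → (+ 6 ℤ.- c) ℤ.* + 1 ℤ.+ (+ 2 ℤ.- c) ℤ.* + posDeg G v ℤ.+ (+ 1 ℤ.- c) ℤ.* + negDeg G v ℤ.+ c ℤ.* + m)
              (order graph v) ⟩
    (+ 6 ℤ.- c) ℤ.* + 1 ℤ.+ (+ 2 ℤ.- c) ℤ.* + posDeg G v ℤ.+ (+ 1 ℤ.- c) ℤ.* + negDeg G v
      ℤ.+ c ℤ.* + (1 + posDeg G v + negDeg G v + countN (Ā G v))
      ≡⟨ cong₂ (λ d⁺ d⁻ → (+ 6 ℤ.- c) ℤ.* + 1 ℤ.+ (+ 2 ℤ.- c) ℤ.* + d⁺ ℤ.+ (+ 1 ℤ.- c) ℤ.* + d⁻
                          ℤ.+ c ℤ.* + (1 + d⁺ + d⁻ + countN (Ā G v)))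
               (proj₁ (degrees v)) (proj₂ (degrees v)) ⟩
    (+ 6 ℤ.- c) ℤ.* + 1 ℤ.+ (+ 2 ℤ.- c) ℤ.* + 4 ℤ.+ (+ 1 ℤ.- c) ℤ.* + 2 ℤ.+ c ℤ.* + (7 + countN (Ā G v)) ∎
    where open ≡-Reasoning

  impossible : Fin n → ⊥
  impossible v =
    let (q , p , vq , vp , q≢p , q̸p) = non-adjacent-pair v
        (t , c≡t) = NonAdjacentPair.c-nonnegative vq vp q≢p q̸p
    in 16+≢4 (t * z) (sym (+-injective (begin
      + 2 ℤ.* + 2                                      ≡⟨ sym (A²-row G net v) ⟩
      ∑ (A² G v)                                       ≡⟨ row-count v ⟩
      (+ 6 ℤ.- c) ℤ.* + 1 ℤ.+ (+ 2 ℤ.- c) ℤ.* + 4 ℤ.+ (+ 1 ℤ.- c) ℤ.* + 2 ℤ.+ c ℤ.* + (7 + z)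
                                                       ≡⟨ cong (λ m → (+ 6 ℤ.- c) ℤ.* + 1 ℤ.+ (+ 2 ℤ.- c) ℤ.* + 4 ℤ.+ (+ 1 ℤ.- c) ℤ.* + 2 ℤ.+ c ℤ.* m)
                                                               (pos-+ 7 z) ⟩
      (+ 6 ℤ.- c) ℤ.* + 1 ℤ.+ (+ 2 ℤ.- c) ℤ.* + 4 ℤ.+ (+ 1 ℤ.- c) ℤ.* + 2 ℤ.+ c ℤ.* (+ 7 ℤ.+ + z)
                                                       ≡⟨ collect c (+ z) ⟩
      + 16 ℤ.+ c ℤ.* + z                               ≡⟨ cong (λ s → + 16 ℤ.+ s ℤ.* + z) c≡t ⟩
      + 16 ℤ.+ + t ℤ.* + z                             ≡⟨ cong (ℤ._+_ (+ 16)) (sym (pos-* t z)) ⟩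
      + 16 ℤ.+ + (t * z)                               ≡⟨ sym (pos-+ 16 (t * z)) ⟩
      + (16 + t * z)                                   ∎)))
    where
    open ≡-Reasoning
    z : ℕ
    z = countN (Ā G v)
    16+≢4 : ∀ m → 16 + m ≢ 4
    16+≢4 m ()
    collect : ∀ c z → (+ 6 ℤ.- c) ℤ.* + 1 ℤ.+ (+ 2 ℤ.- c) ℤ.* + 4 ℤ.+ (+ 1 ℤ.- c) ℤ.* + 2 ℤ.+ c ℤ.* (+ 7 ℤ.+ z)
                      ≡ + 16 ℤ.+ c ℤ.* z
    collect = solve-∀

class⇒2c≢a+b : ∀ {n} {G : SGraph n} {a b c} → C₁ G a b c ⊎ C₄ G a b c ⊎ C₅ G a b c →
               a ≢ - b → a ℤ.+ b ≢ + 0 → + 2 ℤ.* c ≢ a ℤ.+ b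
class⇒2c≢a+b (inj₁ (_ , a≡-b , _))                 a≢-b _      = ⊥-elim (a≢-b a≡-b)
class⇒2c≢a+b (inj₂ (inj₁ (_ , _ , _ , refl)))      _    a+b≢0 = λ 0≡a+b → a+b≢0 (sym 0≡a+b)
class⇒2c≢a+b (inj₂ (inj₂ (_ , _ , _ , 2c≢a+b , _))) _    _      = 2c≢a+b

lemma3p17 : ∀ {n} (G : SGraph n) (a b c : ℤ)
    → IsSignedGraph G
    → IsSRSG G 6 a b c
    → C₁ G a b c ⊎ C₄ G a b c ⊎ C₅ G a b c
    → Connected G
    → ¬ Complete G
    → Regular G 6
    → NetRegular G (+ 2)
    → ¬ ((a ≡ + 2) × (b ≡ + 1))
      × ((a ≡ + 3) × (b ≡ + 1)
         → Isomorphic G S¹₁₅ × n ≡ 15 × IsSRSG G 6 (+ 3) (+ 1) (- (+ 2)))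
lemma3p17 {zero}  G a b c graph srsg _ _ _ _ _ = ⊥-elim (proj₁ (proj₂ srsg) (λ ()))
lemma3p17 {suc n} G a b c graph srsg class _ _ regular net = excluded , characterised
  where
  excluded : ¬ ((a ≡ + 2) × (b ≡ + 1))
  excluded (refl , refl) = Parameters-2-1.impossible graph srsg regular net (class⇒2c≢a+b class (λ ()) (λ ())) zero

  characterised : (a ≡ + 3) × (b ≡ + 1) → Isomorphic G S¹₁₅ × suc n ≡ 15 × IsSRSG G 6 (+ 3) (+ 1) (- (+ 2))
  characterised (refl , refl) =
    isomorphic zero , ↔⇒≡ (⤖⇒↔ (proj₁ (isomorphic zero))) , subst (IsSRSG G 6 (+ 3) (+ 1)) (c≡-2 zero) srsg
    where open Parameters-3-1 graph srsg regular net (class⇒2c≢a+b class (λ ()) (λ ()))
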